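{- For every integer $\gamma\ge 0$, the Hilbert series $\mathcal{H}(t)=\sum_{n\ge1}\dim\mathsf{Dendr}_\gamma(n)\,t^n$ of the operad $\mathsf{Dendr}_\gamma$ satisfies $$\mathcal{H}(t)=t+2\gamma t\,\mathcal{H}(t)+\gamma^2t\,\mathcal{H}(t)^2.$$
   Context: All operads are nonsymmetric operads over a field $\mathbb{K}$ of characteristic zero; $\mathbf{Free}(G)$ denotes the free nonsymmetric operad on a set $G$ of binary generators, and an operad with presentation $(G,R)$, $R\subseteq\mathbf{Free}(G)(3)$, is $\mathbf{Free}(G)/\langle R\rangle$. $[n]=\{1,\dots,n\}$ and $a\downarrow a'=\min(a,a')$. The $\gamma$-polydendriform operad $\mathsf{Dendr}_\gamma$ (the Koszul dual of the $\gamma$-pluriassociative operad $\mathsf{Dias}_\gamma$) is the operad generated by binary elements $\prec_a,\succ_a$, $a\in[\gamma]$, with space of relations spanned by, for all $a,a'\in[\gamma]$: $\prec_a\circ_1\succ_{a'}-\succ_{a'}\circ_2\prec_a$; $\prec_a\circ_1\prec_{a'}-\prec_{a\downarrow a'}\circ_2\prec_a-\prec_{a\downarrow a'}\circ_2\succ_{a'}$; $\succ_{a\downarrow a'}\circ_1\prec_{a'}+\succ_{a\downarrow a'}\circ_1\succ_a-\succ_a\circ_2\succ_{a'}$. -}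

module Defs where

open import Data.Nat using (ℕ; zero; suc; _+_; _*_; _∸_; _≤ᵇ_)
open import Data.Bool using (Bool; true; false; _∧_; if_then_else_)
open import Data.Fin using (Fin; toℕ)
open import Data.Fin.Properties using () renaming (_≟_ to _≟F_)
open import Data.Rational using (ℚ; 0ℚ; 1ℚ; -_) renaming (_+_ to _+q_; _*_ to _*q_)
open import Data.List using (List; []; _∷_; _++_; map; concatMap; foldr; upTo)
open import Data.Nat.ListAction using (sum)
open import Data.List.Relation.Unary.All using (All)
open import Data.Product using (Σ; _×_; _,_; ∃)
open import Relation.Binary.PropositionalEquality using (_≡_)
open import Relation.Nullary.Decidable using (⌊_⌋)
open import Function.Bundles using (_⇔_)

-- Generators of Dendr_γ : ≺_a (false , a) and ≻_a (true , a), a ∈ [γ]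
-- ([γ] = {1..γ} is represented by Fin γ = {0..γ-1}, order preserved).

data Gen (γ : ℕ) : Set where
  prec : Fin γ → Gen γ
  succ : Fin γ → Gen γ

_↓_ : ∀ {γ} → Fin γ → Fin γ → Fin γ
a ↓ a' = if toℕ a ≤ᵇ toℕ a' then a else a'

-- Syntax trees: the basis of the free nonsymmetric operad Free(G).
-- Free(G)(n) has basis the trees of arity n (n leaves).

data Tree (γ : ℕ) : Set where
  leaf : Tree γ
  node : Gen γ → Tree γ → Tree γ → Tree γ

arity : ∀ {γ} → Tree γ → ℕ
arity leaf         = 1
arity (node _ l r) = arity l + arity r

genEq : ∀ {γ} → Gen γ → Gen γ → Bool
genEq (prec a) (prec b) = ⌊ a ≟F b ⌋
genEq (succ a) (succ b) = ⌊ a ≟F b ⌋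
genEq _        _        = false

treeEq : ∀ {γ} → Tree γ → Tree γ → Bool
treeEq leaf leaf = true
treeEq (node g l r) (node g' l' r') = genEq g g' ∧ treeEq l l' ∧ treeEq r r'
treeEq _ _ = false

-- Elements of Free(G): finite formal ℚ-linear combinations of trees.
Comb : ℕ → Set
Comb γ = List (ℚ × Tree γ)

coeff : ∀ {γ} → Comb γ → Tree γ → ℚ
coeff [] t = 0ℚ
coeff ((c , s) ∷ xs) t = (if treeEq s t then c else 0ℚ) +q coeff xs t

scale : ∀ {γ} → ℚ → Comb γ → Comb γ
scale c = map (λ { (d , t) → (c *q d , t) })

HomogeneousOf : ∀ {γ} → ℕ → Comb γ → Set
HomogeneousOf n x = All (λ p → arity (Data.Product.proj₂ p) ≡ n) x

-- ternary tree shapes  g ∘₁ g'  and  g ∘₂ g'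
data Shape (γ : ℕ) : Set where
  c₁ : Gen γ → Gen γ → Shape γ
  c₂ : Gen γ → Gen γ → Shape γ

data Rel (γ : ℕ) : Set where
  r₁ r₂ r₃ : Fin γ → Fin γ → Rel γ

relTerms : ∀ {γ} → Rel γ → List (ℚ × Shape γ)
relTerms (r₁ a a') = (1ℚ , c₁ (prec a) (succ a')) ∷ (- 1ℚ , c₂ (succ a') (prec a)) ∷ []
relTerms (r₂ a a') = (1ℚ , c₁ (prec a) (prec a'))
                   ∷ (- 1ℚ , c₂ (prec (a ↓ a')) (prec a))
                   ∷ (- 1ℚ , c₂ (prec (a ↓ a')) (succ a')) ∷ []
relTerms (r₃ a a') = (1ℚ , c₁ (succ (a ↓ a')) (prec a'))
                   ∷ (1ℚ , c₁ (succ (a ↓ a')) (succ a))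
                   ∷ (- 1ℚ , c₂ (succ a) (succ a')) ∷ []

graft : ∀ {γ} → Shape γ → Tree γ → Tree γ → Tree γ → Tree γ
graft (c₁ g g') x y z = node g (node g' x y) z
graft (c₂ g g') x y z = node g x (node g' y z)

-- Spanning set of the operad ideal ⟨R⟩: a tree in which exactly one
-- ternary position is occupied by a relation, with arbitrary trees
-- grafted above and below (i.e. all compositions s ∘ᵢ (r ∘ (t₁,t₂,t₃))).

data RTree (γ : ℕ) : Set where
  here  : Rel γ → Tree γ → Tree γ → Tree γ → RTree γ
  left  : Gen γ → RTree γ → Tree γ → RTree γ
  right : Gen γ → Tree γ → RTree γ → RTree γ

rarity : ∀ {γ} → RTree γ → ℕ
rarity (here _ x y z) = arity x + arity y + arity z
rarity (left _ r t)   = rarity r + arity t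
rarity (right _ t r)  = arity t + rarity r

expand : ∀ {γ} → RTree γ → Comb γ
expand (here ρ x y z) = map (λ { (c , s) → (c , graft s x y z) }) (relTerms ρ)
expand (left g r t)   = map (λ { (c , s) → (c , node g s t) }) (expand r)
expand (right g t r)  = map (λ { (c , s) → (c , node g t s) }) (expand r)

InIdeal : ∀ {γ} → ℕ → Comb γ → Set
InIdeal {γ} n x =
  Σ (List (ℚ × RTree γ)) λ ys →
    All (λ p → rarity (Data.Product.proj₂ p) ≡ n) ys ×
    (∀ t → coeff x t ≡ coeff (concatMap (λ { (c , r) → scale c (expand r) }) ys) t)

-- dim Dendr_γ(n) = d : there is a linear map φ : Free(G)(n) → ℚ^d
-- (given on the basis of trees) which is surjective and whose kernel is
-- exactly ⟨R⟩(n), i.e. Free(G)(n)/⟨R⟩(n) ≅ ℚ^d.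

applyLin : ∀ {γ d} → (Tree γ → Fin d → ℚ) → Comb γ → Fin d → ℚ
applyLin φ [] i = 0ℚ
applyLin φ ((c , t) ∷ xs) i = c *q φ t i +q applyLin φ xs i

DimDendr : (γ n d : ℕ) → Set
DimDendr γ n d =
  Σ (Tree γ → Fin d → ℚ) λ φ →
    (∀ (v : Fin d → ℚ) → Σ (Comb γ) λ x → HomogeneousOf n x × (∀ i → applyLin φ x i ≡ v i)) ×
    (∀ (x : Comb γ) → HomogeneousOf n x → ((∀ i → applyLin φ x i ≡ 0ℚ) ⇔ InIdeal n x))

-- Coefficients of the formal power series identity
--   H(t) = t + 2γ t H(t) + γ² t H(t)²,   H(t) = Σ_{n≥0} h n tⁿ.

conv : (ℕ → ℕ) → ℕ → ℕ
conv h n = sum (map (λ i → h i * h (n ∸ i)) (upTo (suc n)))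

-- coefficient of t¹ in t (Kronecker delta at n = 0, for t^{n+1})
δ₀ : ℕ → ℕ
δ₀ zero    = 1
δ₀ (suc _) = 0

module Submission where

-- Dendr_γ(n) has a basis of binary trees with n nodes whose edges carry labels in [γ]
-- (the paper's γ-edge valued binary trees). The dendriform products ≺_a, ≻_a act on
-- formal sums of such trees and satisfy the three families of relations, so evaluating a
-- syntax tree through these products (normalize) is a linear map on Free(G)(n) that kills
-- ⟨R⟩(n). Conversely, applying the relations as rewrite rules turns every syntax tree,
-- modulo ⟨R⟩, into the formal sum of its normal forms; hence the kernel is exactly ⟨R⟩(n)
-- and the dimension is the number of such trees. Splitting a tree at its root into two
-- optional labelled subtrees gives H = t (1 + γ H)², which is the stated recurrence.

open import Algebra.Bundles using (CommutativeSemiring)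
import Algebra.Properties.CommutativeSemigroup as CommutativeSemigroupProperties
open import Data.List using (List; []; _∷_; _++_; map; concatMap; foldr; filter)
open import Data.List.Membership.Propositional using (_∈_)
open import Data.List.Membership.Propositional.Properties using (∈-upTo⁻)
open import Data.List.Relation.Unary.All using (All; []; _∷_)
import Data.List.Relation.Unary.All as All
import Data.List.Relation.Unary.All.Properties as All
open import Data.List.Relation.Unary.All.Properties using (applyUpTo⁺₁)
open import Data.List.Relation.Unary.Any using (here; there)
open import Function using (_∘_)
open import Relation.Nullary using (¬_; yes; no)
open import Relation.Unary using (Decidable)
import Relation.Binary.PropositionalEquality as P

module ListSum {c ℓ} (R : CommutativeSemiring c ℓ) where
  open CommutativeSemiring R
  open CommutativeSemigroupProperties +-commutativeSemigroup using (interchange)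
  open import Relation.Binary.Reasoning.Setoid setoid

  ∑ : {A : Set} → (A → Carrier) → List A → Carrier
  ∑ F xs = foldr _+_ 0# (map F xs)

  module _ {A : Set} where

    ∑-cong∈ : {F G : A → Carrier} (xs : List A) → (∀ x → x ∈ xs → F x ≈ G x) → ∑ F xs ≈ ∑ G xs
    ∑-cong∈ []       e = refl
    ∑-cong∈ (x ∷ xs) e = +-cong (e x (here P.refl)) (∑-cong∈ xs (λ y y∈xs → e y (there y∈xs)))

    ∑-cong : {F G : A → Carrier} → (∀ x → F x ≈ G x) → ∀ xs → ∑ F xs ≈ ∑ G xs
    ∑-cong e xs = ∑-cong∈ xs (λ x _ → e x)

    ∑-++ : ∀ (F : A → Carrier) xs ys → ∑ F (xs ++ ys) ≈ ∑ F xs + ∑ F ys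
    ∑-++ F []       ys = sym (+-identityˡ _)
    ∑-++ F (x ∷ xs) ys = trans (+-congˡ (∑-++ F xs ys)) (sym (+-assoc _ _ _))

    ∑-+ : ∀ (F G : A → Carrier) xs → ∑ (λ x → F x + G x) xs ≈ ∑ F xs + ∑ G xs
    ∑-+ F G []       = sym (+-identityˡ 0#)
    ∑-+ F G (x ∷ xs) = trans (+-congˡ (∑-+ F G xs)) (interchange _ _ _ _)

    ∑-0 : ∀ (xs : List A) → ∑ (λ _ → 0#) xs ≈ 0#
    ∑-0 []       = refl
    ∑-0 (x ∷ xs) = trans (+-identityˡ _) (∑-0 xs)

    ∑-*ˡ : ∀ c (F : A → Carrier) xs → ∑ (λ x → c * F x) xs ≈ c * ∑ F xs
    ∑-*ˡ c F []       = sym (zeroʳ c)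
    ∑-*ˡ c F (x ∷ xs) = trans (+-congˡ (∑-*ˡ c F xs)) (sym (distribˡ c _ _))

    ∑-*ʳ : ∀ c (F : A → Carrier) xs → ∑ (λ x → F x * c) xs ≈ ∑ F xs * c
    ∑-*ʳ c F []       = sym (zeroˡ c)
    ∑-*ʳ c F (x ∷ xs) = trans (+-congˡ (∑-*ʳ c F xs)) (sym (distribʳ c _ _))

    ∑-filter : ∀ {P : A → Set} (P? : Decidable P) (F : A → Carrier) →
               (∀ x → ¬ P x → F x ≈ 0#) → ∀ xs → ∑ F (filter P? xs) ≈ ∑ F xs
    ∑-filter P? F F≈0 []       = refl
    ∑-filter P? F F≈0 (x ∷ xs) with P? x
    ... | yes _  = +-congˡ (∑-filter P? F F≈0 xs)
    ... | no ¬Px = trans (∑-filter P? F F≈0 xs) (sym (trans (+-congʳ (F≈0 x ¬Px)) (+-identityˡ _)))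

  module _ {A B : Set} where

    ∑-map : ∀ (F : B → Carrier) (f : A → B) xs → ∑ F (map f xs) ≈ ∑ (F ∘ f) xs
    ∑-map F f []       = refl
    ∑-map F f (x ∷ xs) = +-congˡ (∑-map F f xs)

    ∑-concatMap : ∀ (F : B → Carrier) (g : A → List B) xs →
                  ∑ F (concatMap g xs) ≈ ∑ (λ x → ∑ F (g x)) xs
    ∑-concatMap F g []       = refl
    ∑-concatMap F g (x ∷ xs) = trans (∑-++ F (g x) (concatMap g xs)) (+-congˡ (∑-concatMap F g xs))

    ∑-comm : ∀ (G : A → B → Carrier) xs ys →
             ∑ (λ x → ∑ (G x) ys) xs ≈ ∑ (λ y → ∑ (λ x → G x y) xs) ys
    ∑-comm G []       ys = sym (∑-0 ys)
    ∑-comm G (x ∷ xs) ys = trans (+-congˡ (∑-comm G xs ys)) (sym (∑-+ (G x) _ ys))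


open import Defs
open import Algebra.Bundles using (CommutativeRing)
open import Data.Bool using (true; false; if_then_else_; _∧_)
open import Data.Empty using (⊥-elim)
open import Data.Maybe using (Maybe; just; nothing)
import Data.Maybe as Maybe
import Data.Maybe.Properties as Maybe
open import Data.Fin using (Fin; toℕ) renaming (zero to fzero; suc to fsuc)
open import Data.List using ([_]; concat; length; upTo; lookup; allFin)
import Data.List.Properties as List
open import Data.Nat using (ℕ; zero; suc; _+_; _*_; _∸_; _≤_; _<_; z≤n; s≤s; _⊓_; _≤ᵇ_)
import Data.Nat.Properties as ℕ
open import Data.Product using (Σ; _×_; _,_; proj₁; proj₂; map₁; map₂)
open import Data.Rational using (ℚ; 0ℚ; 1ℚ; -_) renaming (_+_ to _+q_; _*_ to _*q_)
import Data.Rational.Properties as ℚ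
open import Relation.Nullary using (Dec; does; ¬?; _×-dec_)
open import Relation.Nullary.Decidable using (map′; dec-true; dec-false; isYes≗does)
open import Relation.Binary.Definitions using (DecidableEquality)
open import Relation.Nullary.Reflects using (ofʸ; ofⁿ)
open import Data.Fin.Properties using (toℕ-injective) renaming (_≟_ to _≟ᶠ_)
open import Relation.Binary.Bundles using (Setoid; Preorder)
open import Function.Bundles using (mk⇔)
open import Data.Rational.Solver using (module +-*-Solver)
open import Data.Nat.Tactic.RingSolver using (solve-∀)
open import Relation.Binary.PropositionalEquality hiding ([_])

open +-*-Solver using (solve; _:+_; _:*_; _:=_; con)
open ListSum (CommutativeRing.commutativeSemiring ℚ.+-*-commutativeRing)
module ℕΣ = ListSum ℕ.+-*-commutativeSemiring
open CommutativeSemigroupProperties (CommutativeRing.+-commutativeSemigroup ℚ.+-*-commutativeRing)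
  using () renaming (interchange to +q-interchange)

-- A list is read as the formal sum of its entries, so lists are compared through all weightings.
infix 4 _≋_
record _≋_ {A : Set} (xs ys : List A) : Set where
  constructor mk≋
  field ∑-≡ : ∀ (F : A → ℚ) → ∑ F xs ≡ ∑ F ys
open _≋_ public

module _ {A : Set} where

  ≋-refl : {xs : List A} → xs ≋ xs
  ≋-refl = mk≋ λ F → refl

  ≋-sym : {xs ys : List A} → xs ≋ ys → ys ≋ xs
  ≋-sym p = mk≋ λ F → sym (∑-≡ p F)

  ≋-trans : {xs ys zs : List A} → xs ≋ ys → ys ≋ zs → xs ≋ zs
  ≋-trans p q = mk≋ λ F → trans (∑-≡ p F) (∑-≡ q F)

  ≋-reflexive : {xs ys : List A} → xs ≡ ys → xs ≋ ys
  ≋-reflexive refl = ≋-refl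

  ≋-setoid : Setoid _ _
  ≋-setoid = record
    { Carrier = List A ; _≈_ = _≋_
    ; isEquivalence = record { refl = ≋-refl ; sym = ≋-sym ; trans = ≋-trans } }

  ++⁺ : {xs xs′ ys ys′ : List A} → xs ≋ xs′ → ys ≋ ys′ → xs ++ ys ≋ xs′ ++ ys′
  ++⁺ {xs} {xs′} {ys} {ys′} p q = mk≋ λ F → begin
    ∑ F (xs ++ ys)       ≡⟨ ∑-++ F xs ys ⟩
    ∑ F xs +q ∑ F ys     ≡⟨ cong₂ _+q_ (∑-≡ p F) (∑-≡ q F) ⟩
    ∑ F xs′ +q ∑ F ys′   ≡⟨ ∑-++ F xs′ ys′ ⟨
    ∑ F (xs′ ++ ys′)     ∎
    where open ≡-Reasoning

module _ {A B : Set} where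

  map⁺ : ∀ (f : A → B) {xs ys} → xs ≋ ys → map f xs ≋ map f ys
  map⁺ f {xs} {ys} p = mk≋ λ F →
    trans (∑-map F f xs) (trans (∑-≡ p (F ∘ f)) (sym (∑-map F f ys)))

  concatMap⁺ : ∀ {f g : A → List B} {xs ys} → (∀ x → f x ≋ g x) → xs ≋ ys →
               concatMap f xs ≋ concatMap g ys
  concatMap⁺ {f} {g} {xs} {ys} f≋g p = mk≋ λ F → begin
    ∑ F (concatMap f xs)           ≡⟨ ∑-concatMap F f xs ⟩
    ∑ (λ x → ∑ F (f x)) xs         ≡⟨ ∑-cong (λ x → ∑-≡ (f≋g x) F) xs ⟩
    ∑ (λ x → ∑ F (g x)) xs         ≡⟨ ∑-≡ p _ ⟩
    ∑ (λ x → ∑ F (g x)) ys         ≡⟨ ∑-concatMap F g ys ⟨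
    ∑ F (concatMap g ys)           ∎
    where open ≡-Reasoning

  concatMap-cong : ∀ {f g : A → List B} → (∀ x → f x ≋ g x) → ∀ xs → concatMap f xs ≋ concatMap g xs
  concatMap-cong f≋g xs = concatMap⁺ f≋g (≋-refl {xs = xs})

  concatMap-++-distrib : ∀ (f g : A → List B) xs →
                         concatMap (λ x → f x ++ g x) xs ≋ concatMap f xs ++ concatMap g xs
  concatMap-++-distrib f g xs = mk≋ λ F → begin
    ∑ F (concatMap (λ x → f x ++ g x) xs)                ≡⟨ ∑-concatMap F _ xs ⟩
    ∑ (λ x → ∑ F (f x ++ g x)) xs                       ≡⟨ ∑-cong (λ x → ∑-++ F (f x) (g x)) xs ⟩
    ∑ (λ x → ∑ F (f x) +q ∑ F (g x)) xs                 ≡⟨ ∑-+ _ _ xs ⟩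
    ∑ (λ x → ∑ F (f x)) xs +q ∑ (λ x → ∑ F (g x)) xs    ≡⟨ cong₂ _+q_ (∑-concatMap F f xs) (∑-concatMap F g xs) ⟨
    ∑ F (concatMap f xs) +q ∑ F (concatMap g xs)         ≡⟨ ∑-++ F (concatMap f xs) _ ⟨
    ∑ F (concatMap f xs ++ concatMap g xs)               ∎
    where open ≡-Reasoning

  concatMap-regroup : ∀ {f g p q : A → List B} as bs cs ds →
    concatMap f as ≋ concatMap p (cs ++ ds) → concatMap f bs ≋ concatMap q cs →
    concatMap g (as ++ bs) ≋ concatMap q ds →
    concatMap (λ x → f x ++ g x) (as ++ bs) ≋ concatMap (λ y → p y ++ q y) (cs ++ ds)
  concatMap-regroup {f} {g} {p} {q} as bs cs ds fa fb g-ab = begin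
    concatMap (λ x → f x ++ g x) (as ++ bs)
      ≈⟨ concatMap-++-distrib f g (as ++ bs) ⟩
    concatMap f (as ++ bs) ++ concatMap g (as ++ bs)
      ≡⟨ cong (_++ concatMap g (as ++ bs)) (List.concatMap-++ f as bs) ⟩
    (concatMap f as ++ concatMap f bs) ++ concatMap g (as ++ bs)
      ≈⟨ ++⁺ (++⁺ fa fb) g-ab ⟩
    (concatMap p (cs ++ ds) ++ concatMap q cs) ++ concatMap q ds
      ≡⟨ List.++-assoc (concatMap p (cs ++ ds)) _ _ ⟩
    concatMap p (cs ++ ds) ++ (concatMap q cs ++ concatMap q ds)
      ≡⟨ cong (concatMap p (cs ++ ds) ++_) (List.concatMap-++ q cs ds) ⟨
    concatMap p (cs ++ ds) ++ concatMap q (cs ++ ds)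
      ≈⟨ concatMap-++-distrib p q (cs ++ ds) ⟨
    concatMap (λ y → p y ++ q y) (cs ++ ds) ∎
    where open import Relation.Binary.Reasoning.Setoid ≋-setoid

  concatMap-[_] : ∀ (f : A → B) xs → concatMap (λ x → [ f x ]) xs ≡ map f xs
  concatMap-[_] f []       = refl
  concatMap-[_] f (x ∷ xs) = cong (f x ∷_) (concatMap-[_] f xs)

  concatMap-map-comm : ∀ {C : Set} (f : A → B → C) xs ys →
             concatMap (λ x → map (f x) ys) xs ≋ concatMap (λ y → map (λ x → f x y) xs) ys
  concatMap-map-comm f xs ys = mk≋ λ F → begin
    ∑ F (concatMap (λ x → map (f x) ys) xs)           ≡⟨ ∑-concatMap F _ xs ⟩
    ∑ (λ x → ∑ F (map (f x) ys)) xs                   ≡⟨ ∑-cong (λ x → ∑-map F (f x) ys) xs ⟩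
    ∑ (λ x → ∑ (λ y → F (f x y)) ys) xs               ≡⟨ ∑-comm (λ x y → F (f x y)) xs ys ⟩
    ∑ (λ y → ∑ (λ x → F (f x y)) xs) ys               ≡⟨ ∑-cong (λ y → ∑-map F (λ x → f x y) xs) ys ⟨
    ∑ (λ y → ∑ F (map (λ x → f x y) xs)) ys           ≡⟨ ∑-concatMap F _ ys ⟨
    ∑ F (concatMap (λ y → map (λ x → f x y) xs) ys)   ∎
    where open ≡-Reasoning

module _ {A : Set} where

  bilinear : (A → A → List A) → List A → List A → List A
  bilinear f xs ys = concatMap (λ x → concatMap (f x) ys) xs

  ∑-bilinear : ∀ (F : A → ℚ) f xs ys → ∑ F (bilinear f xs ys) ≡ ∑ (λ x → ∑ (λ y → ∑ F (f x y)) ys) xs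
  ∑-bilinear F f xs ys = trans (∑-concatMap F _ xs) (∑-cong (λ x → ∑-concatMap F (f x) ys) xs)

  bilinear⁺ : ∀ f {xs xs′ ys ys′} → xs ≋ xs′ → ys ≋ ys′ → bilinear f xs ys ≋ bilinear f xs′ ys′
  bilinear⁺ f p q = concatMap⁺ (λ x → concatMap⁺ (λ y → ≋-refl {xs = f x y}) q) p

  bilinear-++ʳ : ∀ f xs ys ys′ → bilinear f xs (ys ++ ys′) ≋ bilinear f xs ys ++ bilinear f xs ys′
  bilinear-++ʳ f xs ys ys′ = ≋-trans
    (≋-reflexive (List.concatMap-cong (λ x → List.concatMap-++ (f x) ys ys′) xs))
    (concatMap-++-distrib _ _ xs)

  bilinear-distrib : ∀ f g xs ys → bilinear (λ x y → f x y ++ g x y) xs ys ≋ bilinear f xs ys ++ bilinear g xs ys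
  bilinear-distrib f g xs ys = ≋-trans
    (concatMap-cong (λ x → concatMap-++-distrib (f x) (g x) ys) xs)
    (concatMap-++-distrib _ _ xs)

  bilinear-assoc : ∀ (f g f′ g′ : A → A → List A) →
    (∀ x y z → concatMap (λ w → f w z) (g x y) ≋ concatMap (f′ x) (g′ y z)) →
    ∀ xs ys zs → bilinear f (bilinear g xs ys) zs ≋ bilinear f′ xs (bilinear g′ ys zs)
  bilinear-assoc f g f′ g′ rel xs ys zs = mk≋ sums
    where
    open ≡-Reasoning
    sums : ∀ F → ∑ F (bilinear f (bilinear g xs ys) zs) ≡ ∑ F (bilinear f′ xs (bilinear g′ ys zs))
    sums F = begin
      ∑ F (bilinear f (bilinear g xs ys) zs)
        ≡⟨ ∑-bilinear F f (bilinear g xs ys) zs ⟩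
      ∑ (λ w → ∑ (λ z → ∑ F (f w z)) zs) (bilinear g xs ys)
        ≡⟨ ∑-bilinear _ g xs ys ⟩
      ∑ (λ x → ∑ (λ y → ∑ (λ w → ∑ (λ z → ∑ F (f w z)) zs) (g x y)) ys) xs
        ≡⟨ ∑-cong (λ x → ∑-cong (λ y → ∑-comm _ (g x y) zs) ys) xs ⟩
      ∑ (λ x → ∑ (λ y → ∑ (λ z → ∑ (λ w → ∑ F (f w z)) (g x y)) zs) ys) xs
        ≡⟨ ∑-cong (λ x → ∑-cong (λ y → ∑-cong (λ z → related x y z) zs) ys) xs ⟩
      ∑ (λ x → ∑ (λ y → ∑ (λ z → ∑ (λ v → ∑ F (f′ x v)) (g′ y z)) zs) ys) xs
        ≡⟨ ∑-cong (λ x → ∑-bilinear _ g′ ys zs) xs ⟨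
      ∑ (λ x → ∑ (λ v → ∑ F (f′ x v)) (bilinear g′ ys zs)) xs
        ≡⟨ ∑-bilinear F f′ xs (bilinear g′ ys zs) ⟨
      ∑ F (bilinear f′ xs (bilinear g′ ys zs)) ∎
      where
      related : ∀ x y z → ∑ (λ w → ∑ F (f w z)) (g x y) ≡ ∑ (λ v → ∑ F (f′ x v)) (g′ y z)
      related x y z = trans (sym (∑-concatMap F _ (g x y)))
                            (trans (∑-≡ (rel x y z) F) (∑-concatMap F (f′ x) (g′ y z)))

-- Edge-valued binary trees and their dendriform products

private variable γ : ℕ

toℕ-↓ : (a b : Fin γ) → toℕ (a ↓ b) ≡ toℕ a ⊓ toℕ b
toℕ-↓ a b with toℕ a ≤ᵇ toℕ b | ℕ.≤ᵇ-reflects-≤ (toℕ a) (toℕ b)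
... | true  | ofʸ a≤b = sym (ℕ.m≤n⇒m⊓n≡m a≤b)
... | false | ofⁿ a≰b = sym (ℕ.m≥n⇒m⊓n≡n (ℕ.≰⇒≥ a≰b))

↓-comm : (a b : Fin γ) → a ↓ b ≡ b ↓ a
↓-comm a b = toℕ-injective (begin
  toℕ (a ↓ b)      ≡⟨ toℕ-↓ a b ⟩
  toℕ a ⊓ toℕ b    ≡⟨ ℕ.⊓-comm (toℕ a) (toℕ b) ⟩
  toℕ b ⊓ toℕ a    ≡⟨ toℕ-↓ b a ⟨
  toℕ (b ↓ a)      ∎)
  where open ≡-Reasoning

↓-assoc : (a b c : Fin γ) → a ↓ (b ↓ c) ≡ (a ↓ b) ↓ c
↓-assoc a b c = toℕ-injective (begin
  toℕ (a ↓ (b ↓ c))            ≡⟨ toℕ-↓ a (b ↓ c) ⟩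
  toℕ a ⊓ toℕ (b ↓ c)          ≡⟨ cong (toℕ a ⊓_) (toℕ-↓ b c) ⟩
  toℕ a ⊓ (toℕ b ⊓ toℕ c)      ≡⟨ ℕ.⊓-assoc (toℕ a) (toℕ b) (toℕ c) ⟨
  (toℕ a ⊓ toℕ b) ⊓ toℕ c      ≡⟨ cong (_⊓ toℕ c) (toℕ-↓ a b) ⟨
  toℕ (a ↓ b) ⊓ toℕ c          ≡⟨ toℕ-↓ (a ↓ b) c ⟨
  toℕ ((a ↓ b) ↓ c)            ∎)
  where open ≡-Reasoning

data VTree (γ : ℕ) : Set
data Branch (γ : ℕ) : Set

data VTree γ where
  bin : Branch γ → Branch γ → VTree γ

data Branch γ where
  nil  : Branch γ
  edge : Fin γ → VTree γ → Branch γ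

infixl 6 _≺[_]_ _≻[_]_ _◁[_]_ _▷[_]_
_≺[_]_ _≻[_]_ : VTree γ → Fin γ → VTree γ → List (VTree γ)
_◁[_]_ : Branch γ → Fin γ → VTree γ → List (Branch γ)
_▷[_]_ : VTree γ → Fin γ → Branch γ → List (Branch γ)

bin l r ≺[ c ] y = map (bin l) (r ◁[ c ] y)
x ≻[ c ] bin l r = map (λ l′ → bin l′ r) (x ▷[ c ] l)

nil      ◁[ c ] y = [ edge c y ]
edge b r ◁[ c ] y = map (edge (c ↓ b)) (r ≺[ c ] y ++ r ≻[ b ] y)

x ▷[ c ] nil      = [ edge c x ]
x ▷[ c ] edge a l = map (edge (c ↓ a)) (x ≺[ a ] l ++ x ≻[ c ] l)

≻-≺-assoc : ∀ (x y z : VTree γ) a a′ →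
  concatMap (_≺[ a ] z) (x ≻[ a′ ] y) ≋ concatMap (x ≻[ a′ ]_) (y ≺[ a ] z)
≺-≺-assoc : ∀ (x y z : VTree γ) a a′ →
  concatMap (_≺[ a ] z) (x ≺[ a′ ] y) ≋ concatMap (x ≺[ a ↓ a′ ]_) (y ≺[ a ] z ++ y ≻[ a′ ] z)
≻-≻-assoc : ∀ (x y z : VTree γ) a a′ →
  concatMap (_≻[ a ↓ a′ ] z) (x ≺[ a′ ] y ++ x ≻[ a ] y) ≋ concatMap (x ≻[ a ]_) (y ≻[ a′ ] z)
◁-assoc : ∀ (r : Branch γ) y z a a′ →
  concatMap (_◁[ a ] z) (r ◁[ a′ ] y) ≋ concatMap (r ◁[ a ↓ a′ ]_) (y ≺[ a ] z ++ y ≻[ a′ ] z)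
▷-assoc : ∀ (x y : VTree γ) l a a′ →
  concatMap (_▷[ a ↓ a′ ] l) (x ≺[ a′ ] y ++ x ≻[ a ] y) ≋ concatMap (x ▷[ a ]_) (y ▷[ a′ ] l)

≻-≺-assoc x (bin l r) z a a′ = begin
  concatMap (_≺[ a ] z) (map (λ l′ → bin l′ r) (x ▷[ a′ ] l))
    ≡⟨ List.concatMap-map _ _ (x ▷[ a′ ] l) ⟩
  concatMap (λ l′ → map (bin l′) (r ◁[ a ] z)) (x ▷[ a′ ] l)
    ≈⟨ concatMap-map-comm bin (x ▷[ a′ ] l) (r ◁[ a ] z) ⟩
  concatMap (λ r′ → map (λ l′ → bin l′ r′) (x ▷[ a′ ] l)) (r ◁[ a ] z)
    ≡⟨ List.concatMap-map _ _ (r ◁[ a ] z) ⟨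
  concatMap (x ≻[ a′ ]_) (map (bin l) (r ◁[ a ] z)) ∎
  where open import Relation.Binary.Reasoning.Setoid ≋-setoid

≺-≺-assoc (bin l r) y z a a′ = begin
  concatMap (_≺[ a ] z) (map (bin l) (r ◁[ a′ ] y))
    ≡⟨ List.concatMap-map _ _ (r ◁[ a′ ] y) ⟩
  concatMap (λ r′ → map (bin l) (r′ ◁[ a ] z)) (r ◁[ a′ ] y)
    ≡⟨ List.map-concatMap (bin l) _ (r ◁[ a′ ] y) ⟨
  map (bin l) (concatMap (_◁[ a ] z) (r ◁[ a′ ] y))
    ≈⟨ map⁺ (bin l) (◁-assoc r y z a a′) ⟩
  map (bin l) (concatMap (r ◁[ a ↓ a′ ]_) (y ≺[ a ] z ++ y ≻[ a′ ] z))
    ≡⟨ List.map-concatMap (bin l) _ (y ≺[ a ] z ++ y ≻[ a′ ] z) ⟩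
  concatMap (bin l r ≺[ a ↓ a′ ]_) (y ≺[ a ] z ++ y ≻[ a′ ] z) ∎
  where open import Relation.Binary.Reasoning.Setoid ≋-setoid

≻-≻-assoc x y (bin l r) a a′ = begin
  concatMap (λ w → map (λ l′ → bin l′ r) (w ▷[ a ↓ a′ ] l)) (x ≺[ a′ ] y ++ x ≻[ a ] y)
    ≡⟨ List.map-concatMap _ _ (x ≺[ a′ ] y ++ x ≻[ a ] y) ⟨
  map (λ l′ → bin l′ r) (concatMap (_▷[ a ↓ a′ ] l) (x ≺[ a′ ] y ++ x ≻[ a ] y))
    ≈⟨ map⁺ _ (▷-assoc x y l a a′) ⟩
  map (λ l′ → bin l′ r) (concatMap (x ▷[ a ]_) (y ▷[ a′ ] l))
    ≡⟨ List.map-concatMap _ _ (y ▷[ a′ ] l) ⟩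
  concatMap (λ l′ → x ≻[ a ] bin l′ r) (y ▷[ a′ ] l)
    ≡⟨ List.concatMap-map _ _ (y ▷[ a′ ] l) ⟨
  concatMap (x ≻[ a ]_) (map (λ l′ → bin l′ r) (y ▷[ a′ ] l)) ∎
  where open import Relation.Binary.Reasoning.Setoid ≋-setoid

◁-assoc nil y z a a′ = ≋-reflexive (begin
  map (edge (a ↓ a′)) (y ≺[ a ] z ++ y ≻[ a′ ] z) ++ []
    ≡⟨ List.++-identityʳ _ ⟩
  map (edge (a ↓ a′)) (y ≺[ a ] z ++ y ≻[ a′ ] z)
    ≡⟨ concatMap-[ edge (a ↓ a′) ] _ ⟨
  concatMap (nil ◁[ a ↓ a′ ]_) (y ≺[ a ] z ++ y ≻[ a′ ] z) ∎)
  where open ≡-Reasoning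
◁-assoc (edge b r) y z a a′ = begin
  concatMap (_◁[ a ] z) (map (edge (a′ ↓ b)) (r ≺[ a′ ] y ++ r ≻[ b ] y))
    ≡⟨ List.concatMap-map _ _ (r ≺[ a′ ] y ++ r ≻[ b ] y) ⟩
  concatMap (λ w → map (edge (a ↓ (a′ ↓ b))) (w ≺[ a ] z ++ w ≻[ a′ ↓ b ] z)) (r ≺[ a′ ] y ++ r ≻[ b ] y)
    ≡⟨ List.map-concatMap _ _ (r ≺[ a′ ] y ++ r ≻[ b ] y) ⟨
  map (edge (a ↓ (a′ ↓ b))) (concatMap (λ w → w ≺[ a ] z ++ w ≻[ a′ ↓ b ] z) (r ≺[ a′ ] y ++ r ≻[ b ] y))
    ≈⟨ map⁺ _ (concatMap-regroup (r ≺[ a′ ] y) (r ≻[ b ] y) (y ≺[ a ] z) (y ≻[ a′ ] z) (≺-≺-assoc r y z a a′) (≻-≺-assoc r y z a b) ≻-≻) ⟩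
  map (edge (a ↓ (a′ ↓ b))) (concatMap (λ v → r ≺[ a ↓ a′ ] v ++ r ≻[ b ] v) (y ≺[ a ] z ++ y ≻[ a′ ] z))
    ≡⟨ cong (λ e → map (edge e) (concatMap (λ v → r ≺[ a ↓ a′ ] v ++ r ≻[ b ] v) (y ≺[ a ] z ++ y ≻[ a′ ] z))) (↓-assoc a a′ b) ⟩
  map (edge ((a ↓ a′) ↓ b)) (concatMap (λ v → r ≺[ a ↓ a′ ] v ++ r ≻[ b ] v) (y ≺[ a ] z ++ y ≻[ a′ ] z))
    ≡⟨ List.map-concatMap _ _ (y ≺[ a ] z ++ y ≻[ a′ ] z) ⟩
  concatMap (edge b r ◁[ a ↓ a′ ]_) (y ≺[ a ] z ++ y ≻[ a′ ] z) ∎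
  where
  open import Relation.Binary.Reasoning.Setoid ≋-setoid
  ≻-≻ : concatMap (_≻[ a′ ↓ b ] z) (r ≺[ a′ ] y ++ r ≻[ b ] y) ≋ concatMap (r ≻[ b ]_) (y ≻[ a′ ] z)
  ≻-≻ = subst (λ e → concatMap (_≻[ e ] z) (r ≺[ a′ ] y ++ r ≻[ b ] y) ≋ concatMap (r ≻[ b ]_) (y ≻[ a′ ] z))
              (↓-comm b a′) (≻-≻-assoc r y z b a′)

▷-assoc x y nil a a′ = ≋-reflexive (begin
  concatMap (_▷[ a ↓ a′ ] nil) (x ≺[ a′ ] y ++ x ≻[ a ] y)
    ≡⟨ concatMap-[ edge (a ↓ a′) ] _ ⟩
  map (edge (a ↓ a′)) (x ≺[ a′ ] y ++ x ≻[ a ] y)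
    ≡⟨ List.++-identityʳ _ ⟨
  map (edge (a ↓ a′)) (x ≺[ a′ ] y ++ x ≻[ a ] y) ++ [] ∎)
  where open ≡-Reasoning
▷-assoc x y (edge d l) a a′ = begin
  concatMap (λ w → map (edge ((a ↓ a′) ↓ d)) (w ≺[ d ] l ++ w ≻[ a ↓ a′ ] l)) (x ≺[ a′ ] y ++ x ≻[ a ] y)
    ≡⟨ List.map-concatMap _ _ (x ≺[ a′ ] y ++ x ≻[ a ] y) ⟨
  map (edge ((a ↓ a′) ↓ d)) (concatMap (λ w → w ≺[ d ] l ++ w ≻[ a ↓ a′ ] l) (x ≺[ a′ ] y ++ x ≻[ a ] y))
    ≈⟨ map⁺ _ (concatMap-regroup (x ≺[ a′ ] y) (x ≻[ a ] y) (y ≺[ d ] l) (y ≻[ a′ ] l) ≺-≺ (≻-≺-assoc x y l d a) (≻-≻-assoc x y l a a′)) ⟩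
  map (edge ((a ↓ a′) ↓ d)) (concatMap (λ v → x ≺[ a′ ↓ d ] v ++ x ≻[ a ] v) (y ≺[ d ] l ++ y ≻[ a′ ] l))
    ≡⟨ cong (λ e → map (edge e) (concatMap (λ v → x ≺[ a′ ↓ d ] v ++ x ≻[ a ] v) (y ≺[ d ] l ++ y ≻[ a′ ] l))) (↓-assoc a a′ d) ⟨
  map (edge (a ↓ (a′ ↓ d))) (concatMap (λ v → x ≺[ a′ ↓ d ] v ++ x ≻[ a ] v) (y ≺[ d ] l ++ y ≻[ a′ ] l))
    ≡⟨ List.map-concatMap _ _ (y ≺[ d ] l ++ y ≻[ a′ ] l) ⟩
  concatMap (λ v → x ▷[ a ] edge (a′ ↓ d) v) (y ≺[ d ] l ++ y ≻[ a′ ] l)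
    ≡⟨ List.concatMap-map _ _ (y ≺[ d ] l ++ y ≻[ a′ ] l) ⟨
  concatMap (x ▷[ a ]_) (map (edge (a′ ↓ d)) (y ≺[ d ] l ++ y ≻[ a′ ] l)) ∎
  where
  open import Relation.Binary.Reasoning.Setoid ≋-setoid
  ≺-≺ : concatMap (_≺[ d ] l) (x ≺[ a′ ] y) ≋ concatMap (x ≺[ a′ ↓ d ]_) (y ≺[ d ] l ++ y ≻[ a′ ] l)
  ≺-≺ = subst (λ e → concatMap (_≺[ d ] l) (x ≺[ a′ ] y) ≋ concatMap (x ≺[ e ]_) (y ≺[ d ] l ++ y ≻[ a′ ] l))
              (↓-comm d a′) (≺-≺-assoc x y l d a′)

-- Rewriting syntax trees to normal form modulo ⟨R⟩

mapTrees : (Tree γ → Tree γ) → Comb γ → Comb γ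
mapTrees f = map (map₂ f)

eval : (Tree γ → ℚ) → Comb γ → ℚ
eval G = ∑ (λ p → proj₁ p *q G (proj₂ p))

module _ (G : Tree γ → ℚ) where

  eval-++ : ∀ X Y → eval G (X ++ Y) ≡ eval G X +q eval G Y
  eval-++ = ∑-++ _

  eval-scale : ∀ c X → eval G (scale c X) ≡ c *q eval G X
  eval-scale c X = begin
    eval G (scale c X)                          ≡⟨ ∑-map _ _ X ⟩
    ∑ (λ p → (c *q proj₁ p) *q G (proj₂ p)) X   ≡⟨ ∑-cong (λ p → ℚ.*-assoc c (proj₁ p) _) X ⟩
    ∑ (λ p → c *q (proj₁ p *q G (proj₂ p))) X   ≡⟨ ∑-*ˡ c _ X ⟩
    c *q eval G X                               ∎
    where open ≡-Reasoning

  eval-mapTrees : ∀ f X → eval G (mapTrees f X) ≡ eval (G ∘ f) X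
  eval-mapTrees f X = ∑-map _ _ X

eval-cong : ∀ {G H : Tree γ → ℚ} → (∀ t → G t ≡ H t) → ∀ X → eval G X ≡ eval H X
eval-cong G≡H = ∑-cong (λ p → cong (proj₁ p *q_) (G≡H (proj₂ p)))

applyLin-eval : ∀ {d} (ψ : Tree γ → Fin d → ℚ) X i → applyLin ψ X i ≡ eval (λ t → ψ t i) X
applyLin-eval ψ []            i = refl
applyLin-eval ψ ((c , t) ∷ X) i = cong (c *q ψ t i +q_) (applyLin-eval ψ X i)

eval-0 : ∀ (X : Comb γ) → eval (λ _ → 0ℚ) X ≡ 0ℚ
eval-0 X = trans (∑-cong (λ p → ℚ.*-zeroʳ (proj₁ p)) X) (∑-0 X)

-- The combination used by InIdeal, so that certificates below are InIdeal witnesses verbatim.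
spanned : List (ℚ × RTree γ) → Comb γ
spanned = concatMap (λ p → scale (proj₁ p) (expand (proj₂ p)))

eval-spanned : ∀ (G : Tree γ → ℚ) ys →
  eval G (spanned ys) ≡ ∑ (λ p → proj₁ p *q eval G (expand (proj₂ p))) ys
eval-spanned G ys = trans (∑-concatMap _ _ ys) (∑-cong (λ p → eval-scale G (proj₁ p) (expand (proj₂ p))) ys)

-- X ≈ᴵ Y says X − Y ∈ ⟨R⟩; the difference is compared through every linear functional on trees.
infix 4 _≈ᴵ_
infix 3 _by_
record _≈ᴵ_ (X Y : Comb γ) : Set where
  constructor _by_
  field
    certificate : List (ℚ × RTree γ)
    eval-≡      : ∀ G → eval G X ≡ eval G Y +q eval G (spanned certificate)

module _ {γ : ℕ} where

  ≈ᴵ-reflexive : {X Y : Comb γ} → X ≡ Y → X ≈ᴵ Y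
  ≈ᴵ-reflexive {X} refl = [] by λ G → sym (ℚ.+-identityʳ (eval G X))

  ≈ᴵ-trans : {X Y Z : Comb γ} → X ≈ᴵ Y → Y ≈ᴵ Z → X ≈ᴵ Z
  ≈ᴵ-trans {X} {Y} {Z} (ys by X≈Y) (zs by Y≈Z) = zs ++ ys by λ G → begin
    eval G X                                                    ≡⟨ X≈Y G ⟩
    eval G Y +q eval G (spanned ys)                             ≡⟨ cong (_+q eval G (spanned ys)) (Y≈Z G) ⟩
    (eval G Z +q eval G (spanned zs)) +q eval G (spanned ys)    ≡⟨ ℚ.+-assoc (eval G Z) _ _ ⟩
    eval G Z +q (eval G (spanned zs) +q eval G (spanned ys))    ≡⟨ cong (eval G Z +q_) (eval-++ G (spanned zs) (spanned ys)) ⟨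
    eval G Z +q eval G (spanned zs ++ spanned ys)               ≡⟨ cong (λ W → eval G Z +q eval G W) (List.concatMap-++ _ zs ys) ⟨
    eval G Z +q eval G (spanned (zs ++ ys))                     ∎
    where open ≡-Reasoning

  ≈ᴵ-preorder : Preorder _ _ _
  ≈ᴵ-preorder = record
    { Carrier = Comb γ ; _≈_ = _≡_ ; _≲_ = _≈ᴵ_
    ; isPreorder = record { isEquivalence = isEquivalence ; reflexive = ≈ᴵ-reflexive ; trans = ≈ᴵ-trans } }

  ++⁺ᴵ : {X X′ Y Y′ : Comb γ} → X ≈ᴵ X′ → Y ≈ᴵ Y′ → X ++ Y ≈ᴵ X′ ++ Y′
  ++⁺ᴵ {X} {X′} {Y} {Y′} (xs by X≈X′) (ys by Y≈Y′) = xs ++ ys by λ G → begin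
    eval G (X ++ Y)                                   ≡⟨ eval-++ G X Y ⟩
    eval G X +q eval G Y                              ≡⟨ cong₂ _+q_ (X≈X′ G) (Y≈Y′ G) ⟩
    (eval G X′ +q eval G (spanned xs)) +q (eval G Y′ +q eval G (spanned ys))
      ≡⟨ +q-interchange (eval G X′) _ _ _ ⟩
    (eval G X′ +q eval G Y′) +q (eval G (spanned xs) +q eval G (spanned ys))
      ≡⟨ cong₂ _+q_ (eval-++ G X′ Y′) (trans (cong (eval G) (List.concatMap-++ _ xs ys)) (eval-++ G (spanned xs) (spanned ys))) ⟨
    eval G (X′ ++ Y′) +q eval G (spanned (xs ++ ys))  ∎
    where
    open ≡-Reasoning

  scale⁺ᴵ : ∀ c {X Y : Comb γ} → X ≈ᴵ Y → scale c X ≈ᴵ scale c Y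
  scale⁺ᴵ c {X} {Y} (ys by X≈Y) = map (map₁ (c *q_)) ys by λ G → begin
    eval G (scale c X)                                       ≡⟨ eval-scale G c X ⟩
    c *q eval G X                                            ≡⟨ cong (c *q_) (X≈Y G) ⟩
    c *q (eval G Y +q eval G (spanned ys))                   ≡⟨ ℚ.*-distribˡ-+ c _ _ ⟩
    c *q eval G Y +q c *q eval G (spanned ys)                ≡⟨ cong₂ _+q_ (eval-scale G c Y) (scaled G) ⟨
    eval G (scale c Y) +q eval G (spanned (map (map₁ (c *q_)) ys)) ∎
    where
    open ≡-Reasoning
    scaled : ∀ G → eval G (spanned (map (map₁ (c *q_)) ys)) ≡ c *q eval G (spanned ys)
    scaled G = begin
      eval G (spanned (map (map₁ (c *q_)) ys))
        ≡⟨ eval-spanned G (map (map₁ (c *q_)) ys) ⟩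
      ∑ (λ p → proj₁ p *q eval G (expand (proj₂ p))) (map (map₁ (c *q_)) ys)
        ≡⟨ ∑-map _ _ ys ⟩
      ∑ (λ p → (c *q proj₁ p) *q eval G (expand (proj₂ p))) ys
        ≡⟨ ∑-cong (λ p → ℚ.*-assoc c (proj₁ p) _) ys ⟩
      ∑ (λ p → c *q (proj₁ p *q eval G (expand (proj₂ p)))) ys
        ≡⟨ ∑-*ˡ c _ ys ⟩
      c *q ∑ (λ p → proj₁ p *q eval G (expand (proj₂ p))) ys
        ≡⟨ cong (c *q_) (eval-spanned G ys) ⟨
      c *q eval G (spanned ys) ∎

  context⁺ᴵ : ∀ (f : Tree γ → Tree γ) (h : RTree γ → RTree γ) → (∀ ρ → expand (h ρ) ≡ mapTrees f (expand ρ)) →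
              {X Y : Comb γ} → X ≈ᴵ Y → mapTrees f X ≈ᴵ mapTrees f Y
  context⁺ᴵ f h expand-h {X} {Y} (ys by X≈Y) = map (map₂ h) ys by λ G → begin
    eval G (mapTrees f X)                                          ≡⟨ eval-mapTrees G f X ⟩
    eval (G ∘ f) X                                                 ≡⟨ X≈Y (G ∘ f) ⟩
    eval (G ∘ f) Y +q eval (G ∘ f) (spanned ys)                    ≡⟨ cong₂ _+q_ (eval-mapTrees G f Y) (moved G) ⟨
    eval G (mapTrees f Y) +q eval G (spanned (map (map₂ h) ys))    ∎
    where
    open ≡-Reasoning
    moved : ∀ G → eval G (spanned (map (map₂ h) ys)) ≡ eval (G ∘ f) (spanned ys)
    moved G = begin
      eval G (spanned (map (map₂ h) ys))                                   ≡⟨ eval-spanned G (map (map₂ h) ys) ⟩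
      ∑ (λ p → proj₁ p *q eval G (expand (proj₂ p))) (map (map₂ h) ys)   ≡⟨ ∑-map _ _ ys ⟩
      ∑ (λ p → proj₁ p *q eval G (expand (h (proj₂ p)))) ys              ≡⟨ ∑-cong (λ p → cong (λ W → proj₁ p *q eval G W) (expand-h (proj₂ p))) ys ⟩
      ∑ (λ p → proj₁ p *q eval G (mapTrees f (expand (proj₂ p)))) ys     ≡⟨ ∑-cong (λ p → cong (proj₁ p *q_) (eval-mapTrees G f (expand (proj₂ p)))) ys ⟩
      ∑ (λ p → proj₁ p *q eval (G ∘ f) (expand (proj₂ p))) ys            ≡⟨ eval-spanned (G ∘ f) ys ⟨
      eval (G ∘ f) (spanned ys)                                            ∎

  graftˡ⁺ᴵ : ∀ g (t : Tree γ) {X Y} → X ≈ᴵ Y → mapTrees (λ s → node g s t) X ≈ᴵ mapTrees (λ s → node g s t) Y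
  graftˡ⁺ᴵ g t = context⁺ᴵ _ (λ ρ → left g ρ t) (λ ρ → refl)

  graftʳ⁺ᴵ : ∀ g (t : Tree γ) {X Y} → X ≈ᴵ Y → mapTrees (node g t) X ≈ᴵ mapTrees (node g t) Y
  graftʳ⁺ᴵ g t = context⁺ᴵ _ (right g t) (λ ρ → refl)

module _ {γ : ℕ} where

  concatMap⁺ᴵ : ∀ {A : Set} {f g : A → Comb γ} → (∀ a → f a ≈ᴵ g a) → ∀ as → concatMap f as ≈ᴵ concatMap g as
  concatMap⁺ᴵ f≈g []       = ≈ᴵ-reflexive refl
  concatMap⁺ᴵ f≈g (a ∷ as) = ++⁺ᴵ (f≈g a) (concatMap⁺ᴵ f≈g as)

⌜_⌝ : Tree γ → Comb γ
⌜ t ⌝ = [ (1ℚ , t) ]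

module _ {γ : ℕ} (a a′ : Fin γ) (x y z : Tree γ) where

  ≻≺-relᴵ : ⌜ node (prec a) (node (succ a′) x y) z ⌝ ≈ᴵ ⌜ node (succ a′) x (node (prec a) y z) ⌝
  ≻≺-relᴵ = [ (1ℚ , here (r₁ a a′) x y z) ] by λ G →
    solve 2 (λ p q → con 1ℚ :* p :+ con 0ℚ
                   := (con 1ℚ :* q :+ con 0ℚ) :+ ((con 1ℚ :* con 1ℚ) :* p :+ ((con 1ℚ :* con (- 1ℚ)) :* q :+ con 0ℚ)))
            refl (G (node (prec a) (node (succ a′) x y) z)) (G (node (succ a′) x (node (prec a) y z)))

  ≺≺-relᴵ : ⌜ node (prec a) (node (prec a′) x y) z ⌝ ≈ᴵ
            ⌜ node (prec (a ↓ a′)) x (node (prec a) y z) ⌝ ++ ⌜ node (prec (a ↓ a′)) x (node (succ a′) y z) ⌝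
  ≺≺-relᴵ = [ (1ℚ , here (r₂ a a′) x y z) ] by λ G →
    solve 3 (λ p q r → con 1ℚ :* p :+ con 0ℚ
                     := (con 1ℚ :* q :+ (con 1ℚ :* r :+ con 0ℚ))
                        :+ ((con 1ℚ :* con 1ℚ) :* p :+ ((con 1ℚ :* con (- 1ℚ)) :* q :+ ((con 1ℚ :* con (- 1ℚ)) :* r :+ con 0ℚ))))
            refl (G (node (prec a) (node (prec a′) x y) z))
                 (G (node (prec (a ↓ a′)) x (node (prec a) y z))) (G (node (prec (a ↓ a′)) x (node (succ a′) y z)))

  ≻≻-relᴵ : ⌜ node (succ a) x (node (succ a′) y z) ⌝ ≈ᴵ
            ⌜ node (succ (a ↓ a′)) (node (prec a′) x y) z ⌝ ++ ⌜ node (succ (a ↓ a′)) (node (succ a) x y) z ⌝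
  ≻≻-relᴵ = [ (- 1ℚ , here (r₃ a a′) x y z) ] by λ G →
    solve 3 (λ p q r → con 1ℚ :* r :+ con 0ℚ
                     := (con 1ℚ :* p :+ (con 1ℚ :* q :+ con 0ℚ))
                        :+ ((con (- 1ℚ) :* con 1ℚ) :* p :+ ((con (- 1ℚ) :* con 1ℚ) :* q :+ ((con (- 1ℚ) :* con (- 1ℚ)) :* r :+ con 0ℚ))))
            refl (G (node (succ (a ↓ a′)) (node (prec a′) x y) z)) (G (node (succ (a ↓ a′)) (node (succ a) x y) z))
                 (G (node (succ a) x (node (succ a′) y z)))

emb : VTree γ → Tree γ
embᴸ : Branch γ → Tree γ → Tree γ
embᴿ : Branch γ → Tree γ

emb (bin l r) = embᴸ l (embᴿ r)

embᴸ nil        t = t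
embᴸ (edge a x) t = node (succ a) (emb x) t

embᴿ nil        = leaf
embᴿ (edge b x) = node (prec b) leaf (emb x)

toComb : List (VTree γ) → Comb γ
toComb = map (λ w → (1ℚ , emb w))

module _ {γ : ℕ} where

  toComb-◁ : ∀ e (ws : List (VTree γ)) →
             toComb (map (bin nil) (map (edge e) ws)) ≡ mapTrees (node (prec e) leaf) (toComb ws)
  toComb-◁ e []       = refl
  toComb-◁ e (w ∷ ws) = cong (_ ∷_) (toComb-◁ e ws)

  toComb-▷ : ∀ e r (ws : List (VTree γ)) →
             toComb (map (λ l → bin l r) (map (edge e) ws)) ≡ mapTrees (λ s → node (succ e) s (embᴿ r)) (toComb ws)
  toComb-▷ e r []       = refl
  toComb-▷ e r (w ∷ ws) = cong (_ ∷_) (toComb-▷ e r ws)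

  toComb-bin : ∀ a x (rs : List (Branch γ)) →
               toComb (map (bin (edge a x)) rs) ≡ mapTrees (node (succ a) (emb x)) (toComb (map (bin nil) rs))
  toComb-bin a x []       = refl
  toComb-bin a x (r ∷ rs) = cong (_ ∷_) (toComb-bin a x rs)

  mapTrees-toComb : ∀ f (ws : List (VTree γ)) → mapTrees f (toComb ws) ≡ concatMap (λ w → ⌜ f (emb w) ⌝) ws
  mapTrees-toComb f []       = refl
  mapTrees-toComb f (w ∷ ws) = cong (_ ∷_) (mapTrees-toComb f ws)

rewrite-≺ : ∀ c (x y : VTree γ) → ⌜ node (prec c) (emb x) (emb y) ⌝ ≈ᴵ toComb (x ≺[ c ] y)
rewrite-≻ : ∀ c (x y : VTree γ) → ⌜ node (succ c) (emb x) (emb y) ⌝ ≈ᴵ toComb (x ≻[ c ] y)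
rewrite-◁ : ∀ c (r : Branch γ) y → ⌜ node (prec c) (embᴿ r) (emb y) ⌝ ≈ᴵ toComb (bin nil r ≺[ c ] y)

rewrite-◁ c nil        y = ≈ᴵ-reflexive refl
rewrite-◁ c (edge b r) y = begin
  ⌜ node (prec c) (node (prec b) leaf (emb r)) (emb y) ⌝
    ≲⟨ ≺≺-relᴵ c b leaf (emb r) (emb y) ⟩
  mapTrees (node (prec (c ↓ b)) leaf) (⌜ node (prec c) (emb r) (emb y) ⌝ ++ ⌜ node (succ b) (emb r) (emb y) ⌝)
    ≲⟨ graftʳ⁺ᴵ (prec (c ↓ b)) leaf (++⁺ᴵ (rewrite-≺ c r y) (rewrite-≻ b r y)) ⟩
  mapTrees (node (prec (c ↓ b)) leaf) (toComb (r ≺[ c ] y) ++ toComb (r ≻[ b ] y))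
    ≡⟨ cong (mapTrees _) (List.map-++ _ (r ≺[ c ] y) (r ≻[ b ] y)) ⟨
  mapTrees (node (prec (c ↓ b)) leaf) (toComb (r ≺[ c ] y ++ r ≻[ b ] y))
    ≡⟨ toComb-◁ (c ↓ b) (r ≺[ c ] y ++ r ≻[ b ] y) ⟨
  toComb (bin nil (edge b r) ≺[ c ] y) ∎
  where open import Relation.Binary.Reasoning.Preorder ≈ᴵ-preorder

rewrite-≺ c (bin nil        r) y = rewrite-◁ c r y
rewrite-≺ c (bin (edge a x) r) y = begin
  ⌜ node (prec c) (node (succ a) (emb x) (embᴿ r)) (emb y) ⌝
    ≲⟨ ≻≺-relᴵ c a (emb x) (embᴿ r) (emb y) ⟩
  mapTrees (node (succ a) (emb x)) ⌜ node (prec c) (embᴿ r) (emb y) ⌝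
    ≲⟨ graftʳ⁺ᴵ (succ a) (emb x) (rewrite-◁ c r y) ⟩
  mapTrees (node (succ a) (emb x)) (toComb (bin nil r ≺[ c ] y))
    ≡⟨ toComb-bin a x (r ◁[ c ] y) ⟨
  toComb (bin (edge a x) r ≺[ c ] y) ∎
  where open import Relation.Binary.Reasoning.Preorder ≈ᴵ-preorder

rewrite-≻ c x (bin nil        r) = ≈ᴵ-reflexive refl
rewrite-≻ c x (bin (edge a l) r) = begin
  ⌜ node (succ c) (emb x) (node (succ a) (emb l) (embᴿ r)) ⌝
    ≲⟨ ≻≻-relᴵ c a (emb x) (emb l) (embᴿ r) ⟩
  mapTrees (λ s → node (succ (c ↓ a)) s (embᴿ r)) (⌜ node (prec a) (emb x) (emb l) ⌝ ++ ⌜ node (succ c) (emb x) (emb l) ⌝)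
    ≲⟨ graftˡ⁺ᴵ (succ (c ↓ a)) (embᴿ r) (++⁺ᴵ (rewrite-≺ a x l) (rewrite-≻ c x l)) ⟩
  mapTrees (λ s → node (succ (c ↓ a)) s (embᴿ r)) (toComb (x ≺[ a ] l) ++ toComb (x ≻[ c ] l))
    ≡⟨ cong (mapTrees _) (List.map-++ _ (x ≺[ a ] l) (x ≻[ c ] l)) ⟨
  mapTrees (λ s → node (succ (c ↓ a)) s (embᴿ r)) (toComb (x ≺[ a ] l ++ x ≻[ c ] l))
    ≡⟨ toComb-▷ (c ↓ a) r (x ≺[ a ] l ++ x ≻[ c ] l) ⟨
  toComb (x ≻[ c ] bin (edge a l) r) ∎
  where open import Relation.Binary.Reasoning.Preorder ≈ᴵ-preorder

⟦_⟧ : Gen γ → VTree γ → VTree γ → List (VTree γ)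
⟦ prec c ⟧ = _≺[ c ]_
⟦ succ c ⟧ = _≻[ c ]_

normalize : Tree γ → List (VTree γ)
normalize leaf         = [ bin nil nil ]
normalize (node g l r) = bilinear ⟦ g ⟧ (normalize l) (normalize r)

rewrite-⟦⟧ : ∀ g (x y : VTree γ) → ⌜ node g (emb x) (emb y) ⌝ ≈ᴵ toComb (⟦ g ⟧ x y)
rewrite-⟦⟧ (prec c) = rewrite-≺ c
rewrite-⟦⟧ (succ c) = rewrite-≻ c

normalize-sound : ∀ (t : Tree γ) → ⌜ t ⌝ ≈ᴵ toComb (normalize t)
normalize-sound leaf         = ≈ᴵ-reflexive refl
normalize-sound (node g l r) = begin
  mapTrees (λ s → node g s r) ⌜ l ⌝
    ≲⟨ graftˡ⁺ᴵ g r (normalize-sound l) ⟩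
  mapTrees (λ s → node g s r) (toComb (normalize l))
    ≡⟨ mapTrees-toComb _ (normalize l) ⟩
  concatMap (λ u → mapTrees (node g (emb u)) ⌜ r ⌝) (normalize l)
    ≲⟨ concatMap⁺ᴵ (λ u → graftʳ⁺ᴵ g (emb u) (normalize-sound r)) (normalize l) ⟩
  concatMap (λ u → mapTrees (node g (emb u)) (toComb (normalize r))) (normalize l)
    ≡⟨ List.concatMap-cong (λ u → mapTrees-toComb _ (normalize r)) (normalize l) ⟩
  concatMap (λ u → concatMap (λ v → ⌜ node g (emb u) (emb v) ⌝) (normalize r)) (normalize l)
    ≲⟨ concatMap⁺ᴵ (λ u → concatMap⁺ᴵ (rewrite-⟦⟧ g u) (normalize r)) (normalize l) ⟩
  concatMap (λ u → concatMap (λ v → toComb (⟦ g ⟧ u v)) (normalize r)) (normalize l)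
    ≡⟨ List.concatMap-cong (λ u → List.map-concatMap _ (⟦ g ⟧ u) (normalize r)) (normalize l) ⟨
  concatMap (λ u → toComb (concatMap (⟦ g ⟧ u) (normalize r))) (normalize l)
    ≡⟨ List.map-concatMap _ _ (normalize l) ⟨
  toComb (normalize (node g l r)) ∎
  where open import Relation.Binary.Reasoning.Preorder ≈ᴵ-preorder

normalForm : Comb γ → Comb γ
normalForm = concatMap (λ p → scale (proj₁ p) (toComb (normalize (proj₂ p))))

≈ᴵ-normalForm : ∀ (X : Comb γ) → X ≈ᴵ normalForm X
≈ᴵ-normalForm []            = ≈ᴵ-reflexive refl
≈ᴵ-normalForm ((c , t) ∷ X) = begin
  (c , t) ∷ X
    ≡⟨ cong (λ d → (d , t) ∷ X) (ℚ.*-identityʳ c) ⟨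
  scale c ⌜ t ⌝ ++ X
    ≲⟨ ++⁺ᴵ (scale⁺ᴵ c (normalize-sound t)) (≈ᴵ-normalForm X) ⟩
  normalForm ((c , t) ∷ X) ∎
  where open import Relation.Binary.Reasoning.Preorder ≈ᴵ-preorder

-- Normalization annihilates ⟨R⟩

module _ {γ : ℕ} (a a′ : Fin γ) (xs ys zs : List (VTree γ)) where
  open import Relation.Binary.Reasoning.Setoid (≋-setoid {A = VTree γ})

  bilinear-≻≺ : bilinear _≺[ a ]_ (bilinear _≻[ a′ ]_ xs ys) zs ≋ bilinear _≻[ a′ ]_ xs (bilinear _≺[ a ]_ ys zs)
  bilinear-≻≺ = bilinear-assoc _≺[ a ]_ _≻[ a′ ]_ _≻[ a′ ]_ _≺[ a ]_ (λ x y z → ≻-≺-assoc x y z a a′) xs ys zs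

  bilinear-≺≺ : bilinear _≺[ a ]_ (bilinear _≺[ a′ ]_ xs ys) zs ≋
                bilinear _≺[ a ↓ a′ ]_ xs (bilinear _≺[ a ]_ ys zs) ++ bilinear _≺[ a ↓ a′ ]_ xs (bilinear _≻[ a′ ]_ ys zs)
  bilinear-≺≺ = begin
    bilinear _≺[ a ]_ (bilinear _≺[ a′ ]_ xs ys) zs
      ≈⟨ bilinear-assoc _≺[ a ]_ _≺[ a′ ]_ _≺[ a ↓ a′ ]_ (λ y z → y ≺[ a ] z ++ y ≻[ a′ ] z)
                     (λ x y z → ≺-≺-assoc x y z a a′) xs ys zs ⟩
    bilinear _≺[ a ↓ a′ ]_ xs (bilinear (λ y z → y ≺[ a ] z ++ y ≻[ a′ ] z) ys zs)
      ≈⟨ bilinear⁺ _ (≋-refl {xs = xs}) (bilinear-distrib _≺[ a ]_ _≻[ a′ ]_ ys zs) ⟩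
    bilinear _≺[ a ↓ a′ ]_ xs (bilinear _≺[ a ]_ ys zs ++ bilinear _≻[ a′ ]_ ys zs)
      ≈⟨ bilinear-++ʳ _ xs (bilinear _≺[ a ]_ ys zs) (bilinear _≻[ a′ ]_ ys zs) ⟩
    bilinear _≺[ a ↓ a′ ]_ xs (bilinear _≺[ a ]_ ys zs) ++ bilinear _≺[ a ↓ a′ ]_ xs (bilinear _≻[ a′ ]_ ys zs) ∎

  bilinear-≻≻ : bilinear _≻[ a ↓ a′ ]_ (bilinear _≺[ a′ ]_ xs ys) zs ++ bilinear _≻[ a ↓ a′ ]_ (bilinear _≻[ a ]_ xs ys) zs ≋
                bilinear _≻[ a ]_ xs (bilinear _≻[ a′ ]_ ys zs)
  bilinear-≻≻ = begin
    bilinear _≻[ a ↓ a′ ]_ (bilinear _≺[ a′ ]_ xs ys) zs ++ bilinear _≻[ a ↓ a′ ]_ (bilinear _≻[ a ]_ xs ys) zs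
      ≡⟨ List.concatMap-++ (λ w → concatMap (w ≻[ a ↓ a′ ]_) zs) (bilinear _≺[ a′ ]_ xs ys) (bilinear _≻[ a ]_ xs ys) ⟨
    bilinear _≻[ a ↓ a′ ]_ (bilinear _≺[ a′ ]_ xs ys ++ bilinear _≻[ a ]_ xs ys) zs
      ≈⟨ bilinear⁺ _ (≋-sym (bilinear-distrib _≺[ a′ ]_ _≻[ a ]_ xs ys)) (≋-refl {xs = zs}) ⟩
    bilinear _≻[ a ↓ a′ ]_ (bilinear (λ x y → x ≺[ a′ ] y ++ x ≻[ a ] y) xs ys) zs
      ≈⟨ bilinear-assoc _≻[ a ↓ a′ ]_ (λ x y → x ≺[ a′ ] y ++ x ≻[ a ] y) _≻[ a ]_ _≻[ a′ ]_
                     (λ x y z → ≻-≻-assoc x y z a a′) xs ys zs ⟩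
    bilinear _≻[ a ]_ xs (bilinear _≻[ a′ ]_ ys zs) ∎

normalized : (VTree γ → ℚ) → Tree γ → ℚ
normalized F t = ∑ F (normalize t)

cancel₂ : ∀ p q → p ≡ q → 1ℚ *q p +q ((- 1ℚ) *q q +q 0ℚ) ≡ 0ℚ
cancel₂ p .p refl = solve 1 (λ p → con 1ℚ :* p :+ (con (- 1ℚ) :* p :+ con 0ℚ) := con 0ℚ) refl p

cancel₃ : ∀ p q r → p ≡ q +q r → 1ℚ *q p +q ((- 1ℚ) *q q +q ((- 1ℚ) *q r +q 0ℚ)) ≡ 0ℚ
cancel₃ .(q +q r) q r refl =
  solve 2 (λ q r → con 1ℚ :* (q :+ r) :+ (con (- 1ℚ) :* q :+ (con (- 1ℚ) :* r :+ con 0ℚ)) := con 0ℚ) refl q r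

cancel₃′ : ∀ p q r → p +q q ≡ r → 1ℚ *q p +q (1ℚ *q q +q ((- 1ℚ) *q r +q 0ℚ)) ≡ 0ℚ
cancel₃′ p q .(p +q q) refl =
  solve 2 (λ p q → con 1ℚ :* p :+ (con 1ℚ :* q :+ (con (- 1ℚ) :* (p :+ q) :+ con 0ℚ)) := con 0ℚ) refl p q

expand-annihilated : ∀ (ρ : RTree γ) F → eval (normalized F) (expand ρ) ≡ 0ℚ
expand-annihilated (here (r₁ a a′) x y z) F =
  cancel₂ _ _ (∑-≡ (bilinear-≻≺ a a′ (normalize x) (normalize y) (normalize z)) F)
expand-annihilated (here (r₂ a a′) x y z) F =
  cancel₃ _ (∑ F (normalize u)) (∑ F (normalize v))
    (trans (∑-≡ (bilinear-≺≺ a a′ (normalize x) (normalize y) (normalize z)) F) (∑-++ F (normalize u) (normalize v)))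
  where u = node (prec (a ↓ a′)) x (node (prec a) y z)
        v = node (prec (a ↓ a′)) x (node (succ a′) y z)
expand-annihilated (here (r₃ a a′) x y z) F =
  cancel₃′ (∑ F (normalize u)) (∑ F (normalize v)) _
    (trans (sym (∑-++ F (normalize u) (normalize v))) (∑-≡ (bilinear-≻≻ a a′ (normalize x) (normalize y) (normalize z)) F))
  where u = node (succ (a ↓ a′)) (node (prec a′) x y) z
        v = node (succ (a ↓ a′)) (node (succ a) x y) z
expand-annihilated (left g ρ t) F = begin
  eval (normalized F) (mapTrees (λ s → node g s t) (expand ρ))  ≡⟨ eval-mapTrees _ _ (expand ρ) ⟩
  eval (λ s → normalized F (node g s t)) (expand ρ)             ≡⟨ eval-cong (λ s → ∑-bilinear F ⟦ g ⟧ (normalize s) (normalize t)) (expand ρ) ⟩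
  eval (normalized (λ u → ∑ (λ v → ∑ F (⟦ g ⟧ u v)) (normalize t))) (expand ρ)
                                                                ≡⟨ expand-annihilated ρ _ ⟩
  0ℚ                                                            ∎
  where open ≡-Reasoning
expand-annihilated (right g t ρ) F = begin
  eval (normalized F) (mapTrees (node g t) (expand ρ))  ≡⟨ eval-mapTrees _ _ (expand ρ) ⟩
  eval (λ s → normalized F (node g t s)) (expand ρ)
    ≡⟨ eval-cong (λ s → trans (∑-bilinear F ⟦ g ⟧ (normalize t) (normalize s)) (∑-comm _ (normalize t) (normalize s))) (expand ρ) ⟩
  eval (normalized (λ v → ∑ (λ u → ∑ F (⟦ g ⟧ u v)) (normalize t))) (expand ρ)
                                                        ≡⟨ expand-annihilated ρ _ ⟩
  0ℚ                                                    ∎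
  where open ≡-Reasoning

module _ {γ : ℕ} where

  _≟ᵍ_ : DecidableEquality (Gen γ)
  prec a ≟ᵍ prec b = map′ (cong prec) (λ { refl → refl }) (a ≟ᶠ b)
  succ a ≟ᵍ succ b = map′ (cong succ) (λ { refl → refl }) (a ≟ᶠ b)
  prec a ≟ᵍ succ b = no λ ()
  succ a ≟ᵍ prec b = no λ ()

  _≟ᵗ_ : DecidableEquality (Tree γ)
  leaf       ≟ᵗ leaf          = yes refl
  leaf       ≟ᵗ node _ _ _    = no λ ()
  node _ _ _ ≟ᵗ leaf          = no λ ()
  node g l r ≟ᵗ node g′ l′ r′ =
    map′ (λ { (refl , refl , refl) → refl }) (λ { refl → refl , refl , refl }) (g ≟ᵍ g′ ×-dec l ≟ᵗ l′ ×-dec r ≟ᵗ r′)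

  genEq-does : ∀ (g h : Gen γ) → genEq g h ≡ does (g ≟ᵍ h)
  genEq-does (prec a) (prec b) = isYes≗does (a ≟ᶠ b)
  genEq-does (succ a) (succ b) = isYes≗does (a ≟ᶠ b)
  genEq-does (prec a) (succ b) = refl
  genEq-does (succ a) (prec b) = refl

  treeEq-does : ∀ (s t : Tree γ) → treeEq s t ≡ does (s ≟ᵗ t)
  treeEq-does leaf         leaf            = refl
  treeEq-does leaf         (node _ _ _)    = refl
  treeEq-does (node _ _ _) leaf            = refl
  treeEq-does (node g l r) (node g′ l′ r′) =
    cong₂ _∧_ (genEq-does g g′) (cong₂ _∧_ (treeEq-does l l′) (treeEq-does r r′))

  coeff-∷ : ∀ c (s : Tree γ) X t → coeff ((c , s) ∷ X) t ≡ (if does (s ≟ᵗ t) then c else 0ℚ) +q coeff X t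
  coeff-∷ c s X t = cong (λ b → (if b then c else 0ℚ) +q coeff X t) (treeEq-does s t)

  𝟙[_] : Tree γ → Tree γ → ℚ
  𝟙[ t ] s = if does (s ≟ᵗ t) then 1ℚ else 0ℚ

  coeff-eval : ∀ X t → coeff X t ≡ eval 𝟙[ t ] X
  coeff-eval []            t = refl
  coeff-eval ((c , s) ∷ X) t = trans (coeff-∷ c s X t) (cong₂ _+q_ (ite (does (s ≟ᵗ t))) (coeff-eval X t))
    where
    ite : ∀ b → (if b then c else 0ℚ) ≡ c *q (if b then 1ℚ else 0ℚ)
    ite true  = sym (ℚ.*-identityʳ c)
    ite false = sym (ℚ.*-zeroʳ c)

  remove : Tree γ → Comb γ → Comb γ
  remove s = filter (λ p → ¬? (proj₂ p ≟ᵗ s))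

  eval-remove : ∀ G s X → eval G X ≡ coeff X s *q G s +q eval G (remove s X)
  eval-remove G s [] = sym (trans (cong (_+q 0ℚ) (ℚ.*-zeroˡ (G s))) (ℚ.+-identityˡ 0ℚ))
  eval-remove G s ((c , u) ∷ X) rewrite coeff-∷ c u X s with u ≟ᵗ s
  ... | yes refl = begin
    c *q G s +q eval G X                                     ≡⟨ cong (c *q G s +q_) (eval-remove G s X) ⟩
    c *q G s +q (coeff X s *q G s +q eval G (remove s X))    ≡⟨ solve 4 (λ c d g e → c :* g :+ (d :* g :+ e) := (c :+ d) :* g :+ e) refl c (coeff X s) (G s) _ ⟩
    (c +q coeff X s) *q G s +q eval G (remove s X)           ∎
    where
    open ≡-Reasoning
  ... | no _ = begin
    c *q G u +q eval G X                                     ≡⟨ cong (c *q G u +q_) (eval-remove G s X) ⟩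
    c *q G u +q (coeff X s *q G s +q eval G (remove s X))    ≡⟨ solve 5 (λ x gu d g e → x :* gu :+ (d :* g :+ e) := (con 0ℚ :+ d) :* g :+ (x :* gu :+ e)) refl c (G u) (coeff X s) (G s) _ ⟩
    (0ℚ +q coeff X s) *q G s +q (c *q G u +q eval G (remove s X)) ∎
    where
    open ≡-Reasoning

  coeff-∷-≢ : ∀ c {s t : Tree γ} X → s ≢ t → coeff ((c , s) ∷ X) t ≡ coeff X t
  coeff-∷-≢ c {s} {t} X s≢t =
    trans (coeff-∷ c s X t) (trans (cong (λ b → (if b then c else 0ℚ) +q coeff X t) (dec-false (s ≟ᵗ t) s≢t))
                                   (ℚ.+-identityˡ _))

  coeff-remove-self : ∀ s X → coeff (remove s X) s ≡ 0ℚ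
  coeff-remove-self s []            = refl
  coeff-remove-self s ((c , u) ∷ X) with u ≟ᵗ s
  ... | yes refl = coeff-remove-self s X
  ... | no u≢s   = trans (coeff-∷-≢ c (remove s X) u≢s) (coeff-remove-self s X)

  coeff-remove-other : ∀ {s t} X → s ≢ t → coeff (remove s X) t ≡ coeff X t
  coeff-remove-other         []            s≢t = refl
  coeff-remove-other {s} {t} ((c , u) ∷ X) s≢t with u ≟ᵗ s
  ... | yes refl = trans (coeff-remove-other X s≢t) (sym (coeff-∷-≢ c X s≢t))
  ... | no _     = trans (coeff-∷ c u (remove s X) t)
                         (trans (cong ((if does (u ≟ᵗ t) then c else 0ℚ) +q_) (coeff-remove-other X s≢t))
                                (sym (coeff-∷ c u X t)))

  eval-null : ∀ G n (Z : Comb γ) → length Z ≤ n → (∀ t → coeff Z t ≡ 0ℚ) → eval G Z ≡ 0ℚ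
  eval-null G n       []            _          _    = refl
  eval-null G (suc n) ((c , s) ∷ Z) (s≤s |Z|≤n) null = begin
    eval G ((c , s) ∷ Z)                                            ≡⟨ eval-remove G s ((c , s) ∷ Z) ⟩
    coeff ((c , s) ∷ Z) s *q G s +q eval G (remove s ((c , s) ∷ Z)) ≡⟨ cong₂ (λ a b → a *q G s +q b) (null s) rest ⟩
    0ℚ *q G s +q 0ℚ                                                 ≡⟨ cong (_+q 0ℚ) (ℚ.*-zeroˡ (G s)) ⟩
    0ℚ                                                              ∎
    where
    open ≡-Reasoning
    rest : eval G (remove s ((c , s) ∷ Z)) ≡ 0ℚ
    rest = eval-null G n (remove s ((c , s) ∷ Z))
      (subst (λ W → length W ≤ n) (sym (List.filter-reject (λ p → ¬? (proj₂ p ≟ᵗ s)) (λ s≢s → s≢s refl)))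
             (ℕ.≤-trans (List.length-filter (λ p → ¬? (proj₂ p ≟ᵗ s)) Z) |Z|≤n))
      λ t → case-≟ t (s ≟ᵗ t)
      where
      case-≟ : ∀ t → Dec (s ≡ t) → coeff (remove s ((c , s) ∷ Z)) t ≡ 0ℚ
      case-≟ t (yes refl) = coeff-remove-self s ((c , s) ∷ Z)
      case-≟ t (no s≢t)   = trans (coeff-remove-other ((c , s) ∷ Z) s≢t) (null t)

  eval-coeff-cong : ∀ G (X Y : Comb γ) → (∀ t → coeff X t ≡ coeff Y t) → eval G X ≡ eval G Y
  eval-coeff-cong G X Y X≡Y = begin
    eval G X                                        ≡⟨ solve 2 (λ x y → x := (x :+ con (- 1ℚ) :* y) :+ y) refl (eval G X) (eval G Y) ⟩
    (eval G X +q (- 1ℚ) *q eval G Y) +q eval G Y    ≡⟨ cong (_+q eval G Y) (difference G) ⟨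
    eval G D +q eval G Y                            ≡⟨ cong (_+q eval G Y) (eval-null G _ D ℕ.≤-refl λ t → trans (coeff-eval D t) (trans (difference 𝟙[ t ]) (null t))) ⟩
    0ℚ +q eval G Y                                  ≡⟨ ℚ.+-identityˡ (eval G Y) ⟩
    eval G Y                                        ∎
    where
    open ≡-Reasoning
    D = X ++ scale (- 1ℚ) Y
    difference : ∀ H → eval H D ≡ eval H X +q (- 1ℚ) *q eval H Y
    difference H = trans (eval-++ H X _) (cong (eval H X +q_) (eval-scale H (- 1ℚ) Y))
    null : ∀ t → eval 𝟙[ t ] X +q (- 1ℚ) *q eval 𝟙[ t ] Y ≡ 0ℚ
    null t = begin
      eval 𝟙[ t ] X +q (- 1ℚ) *q eval 𝟙[ t ] Y      ≡⟨ cong₂ (λ a b → a +q (- 1ℚ) *q b) (coeff-eval X t) (coeff-eval Y t) ⟨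
      coeff X t +q (- 1ℚ) *q coeff Y t              ≡⟨ cong (λ a → a +q (- 1ℚ) *q coeff Y t) (X≡Y t) ⟩
      coeff Y t +q (- 1ℚ) *q coeff Y t              ≡⟨ solve 1 (λ y → y :+ con (- 1ℚ) :* y := con 0ℚ) refl (coeff Y t) ⟩
      0ℚ                                            ∎

-- Counting edge-valued trees

δ : ℕ → ℕ → ℕ
δ zero    zero    = 1
δ zero    (suc _) = 0
δ (suc _) zero    = 0
δ (suc m) (suc n) = δ m n

δ-refl : ∀ n → δ n n ≡ 1
δ-refl zero    = refl
δ-refl (suc n) = δ-refl n

δ-sym : ∀ m n → δ m n ≡ δ n m
δ-sym zero    zero    = refl
δ-sym zero    (suc n) = refl
δ-sym (suc m) zero    = refl
δ-sym (suc m) (suc n) = δ-sym m n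

δ-sound : ∀ m n → 1 ≤ δ m n → m ≡ n
δ-sound zero    zero    _  = refl
δ-sound (suc m) (suc n) le = cong suc (δ-sound m n le)

δ-< : ∀ {m n} → n < m → δ m n ≡ 0
δ-< {suc m} {zero}  _         = refl
δ-< {suc m} {suc n} (s≤s n<m) = δ-< n<m

δ-+ : ∀ p m n → δ (p + m) (p + n) ≡ δ m n
δ-+ zero    m n = refl
δ-+ (suc p) m n = δ-+ p m n

δ-∸ : ∀ {i n} → i ≤ n → δ (n ∸ i) 0 ≡ δ n i
δ-∸ {zero}  _         = refl
δ-∸ {suc i} (s≤s i≤n) = δ-∸ i≤n

δ₀-δ : ∀ n → δ₀ n ≡ δ 0 n
δ₀-δ zero    = refl
δ₀-δ (suc n) = refl

∑-upTo-suc : ∀ (F : ℕ → ℕ) m → ℕΣ.∑ F (upTo (suc m)) ≡ F 0 + ℕΣ.∑ (F ∘ suc) (upTo m)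
∑-upTo-suc F m = cong (F 0 +_) (trans (cong (ℕΣ.∑ F) (sym (List.map-upTo suc m))) (ℕΣ.∑-map F suc (upTo m)))

∑-δ : ∀ (G : ℕ → ℕ) p m → p < m → ℕΣ.∑ (λ i → δ p i * G i) (upTo m) ≡ G p
∑-δ G zero    (suc m) _         = begin
  ℕΣ.∑ (λ i → δ 0 i * G i) (upTo (suc m))  ≡⟨ ∑-upTo-suc (λ i → δ 0 i * G i) m ⟩
  (G 0 + 0) + ℕΣ.∑ (λ _ → 0) (upTo m)      ≡⟨ cong₂ _+_ (ℕ.+-identityʳ (G 0)) (ℕΣ.∑-0 (upTo m)) ⟩
  G 0 + 0                                  ≡⟨ ℕ.+-identityʳ (G 0) ⟩
  G 0                                      ∎
  where open ≡-Reasoning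
∑-δ G (suc p) (suc m) (s≤s p<m) = trans (∑-upTo-suc (λ i → δ (suc p) i * G i) m) (∑-δ (G ∘ suc) p m p<m)

∑-δ-out : ∀ (G : ℕ → ℕ) p m → m ≤ p → ℕΣ.∑ (λ i → δ p i * G i) (upTo m) ≡ 0
∑-δ-out G p       zero    _         = refl
∑-δ-out G (suc p) (suc m) (s≤s m≤p) = trans (∑-upTo-suc (λ i → δ (suc p) i * G i) m) (∑-δ-out (G ∘ suc) p m m≤p)

∑-δδ : ∀ p q n → ℕΣ.∑ (λ i → δ p i * δ q (n ∸ i)) (upTo (suc n)) ≡ δ (p + q) n
∑-δδ p q n with p ℕ.≤? n
... | yes p≤n = begin
  ℕΣ.∑ (λ i → δ p i * δ q (n ∸ i)) (upTo (suc n))  ≡⟨ ∑-δ (λ i → δ q (n ∸ i)) p (suc n) (s≤s p≤n) ⟩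
  δ q (n ∸ p)                                      ≡⟨ δ-+ p q (n ∸ p) ⟨
  δ (p + q) (p + (n ∸ p))                          ≡⟨ cong (δ (p + q)) (ℕ.m+[n∸m]≡n p≤n) ⟩
  δ (p + q) n                                      ∎
  where open ≡-Reasoning
... | no p≰n = trans (∑-δ-out _ p (suc n) (ℕ.≰⇒> p≰n))
                     (sym (δ-< (ℕ.<-≤-trans (ℕ.≰⇒> p≰n) (ℕ.m≤m+n p q))))

private
  distribute : ∀ c d e x y → (d + c * x) * (e + c * y) ≡ ((d * e + d * (c * y)) + c * x * e) + c * c * (x * y)
  distribute = solve-∀

  collect : ∀ c d x z → ((d + c * x) + c * x) + c * c * z ≡ d + 2 * c * x + c * c * z
  collect = solve-∀

module _ (c : ℕ) (h : ℕ → ℕ) (n : ℕ) where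

  private
    I = upTo (suc n)
    A B C D : ℕ → ℕ
    A i = δ i 0 * δ (n ∸ i) 0
    B i = δ i 0 * (c * h (n ∸ i))
    C i = c * h i * δ (n ∸ i) 0
    D i = c * c * (h i * h (n ∸ i))

  ∑-convolution : ℕΣ.∑ (λ i → (δ i 0 + c * h i) * (δ (n ∸ i) 0 + c * h (n ∸ i))) (upTo (suc n)) ≡
                  δ₀ n + 2 * c * h n + c * c * conv h n
  ∑-convolution = begin
    ℕΣ.∑ (λ i → (δ i 0 + c * h i) * (δ (n ∸ i) 0 + c * h (n ∸ i))) I
      ≡⟨ ℕΣ.∑-cong (λ i → distribute c (δ i 0) (δ (n ∸ i) 0) (h i) (h (n ∸ i))) I ⟩
    ℕΣ.∑ (λ i → ((A i + B i) + C i) + D i) I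
      ≡⟨ ℕΣ.∑-+ (λ i → (A i + B i) + C i) D I ⟩
    ℕΣ.∑ (λ i → (A i + B i) + C i) I + ℕΣ.∑ D I
      ≡⟨ cong (_+ ℕΣ.∑ D I) (trans (ℕΣ.∑-+ (λ i → A i + B i) C I) (cong (_+ ℕΣ.∑ C I) (ℕΣ.∑-+ A B I))) ⟩
    ((ℕΣ.∑ A I + ℕΣ.∑ B I) + ℕΣ.∑ C I) + ℕΣ.∑ D I
      ≡⟨ cong₂ _+_ (cong₂ _+_ (cong₂ _+_ unit first) last) (ℕΣ.∑-*ˡ (c * c) _ I) ⟩
    ((δ₀ n + c * h n) + c * h n) + c * c * conv h n
      ≡⟨ collect c (δ₀ n) (h n) (conv h n) ⟩
    δ₀ n + 2 * c * h n + c * c * conv h n ∎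
    where
    open ≡-Reasoning
    unit : ℕΣ.∑ (λ i → δ i 0 * δ (n ∸ i) 0) I ≡ δ₀ n
    unit = begin
      ℕΣ.∑ (λ i → δ i 0 * δ (n ∸ i) 0) I  ≡⟨ ℕΣ.∑-cong (λ i → cong₂ _*_ (δ-sym i 0) (δ-sym (n ∸ i) 0)) I ⟩
      ℕΣ.∑ (λ i → δ 0 i * δ 0 (n ∸ i)) I  ≡⟨ ∑-δδ 0 0 n ⟩
      δ 0 n                               ≡⟨ δ₀-δ n ⟨
      δ₀ n                                ∎
    first : ℕΣ.∑ (λ i → δ i 0 * (c * h (n ∸ i))) I ≡ c * h n
    first = trans (ℕΣ.∑-cong (λ i → cong (_* (c * h (n ∸ i))) (δ-sym i 0)) I) (∑-δ (λ i → c * h (n ∸ i)) 0 (suc n) (s≤s z≤n))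
    last : ℕΣ.∑ (λ i → c * h i * δ (n ∸ i) 0) I ≡ c * h n
    last = begin
      ℕΣ.∑ (λ i → c * h i * δ (n ∸ i) 0) I  ≡⟨ ℕΣ.∑-cong∈ I (λ i i∈I → trans (cong (c * h i *_) (δ-∸ (ℕ.≤-pred (∈-upTo⁻ i∈I)))) (ℕ.*-comm (c * h i) (δ n i))) ⟩
      ℕΣ.∑ (λ i → δ n i * (c * h i)) I      ≡⟨ ∑-δ (λ i → c * h i) n (suc n) ℕ.≤-refl ⟩
      c * h n                               ∎

multiplicity : {A : Set} → DecidableEquality A → A → List A → ℕ
multiplicity _≟_ w = ℕΣ.∑ (λ u → if does (u ≟ w) then 1 else 0)

if-∧ : ∀ b c → (if b ∧ c then 1 else 0) ≡ (if b then 1 else 0) * (if c then 1 else 0)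
if-∧ true  true  = refl
if-∧ true  false = refl
if-∧ false c     = refl

multiplicity-allFin : ∀ {n} (b : Fin n) → multiplicity _≟ᶠ_ b (allFin n) ≡ 1
multiplicity-allFin {suc n} b = trans (∑-allFin-suc b) (split b)
  where
  ∑-allFin-suc : ∀ (b : Fin (suc n)) → multiplicity _≟ᶠ_ b (allFin (suc n)) ≡
               (if does (fzero ≟ᶠ b) then 1 else 0) + ℕΣ.∑ (λ a → if does (fsuc a ≟ᶠ b) then 1 else 0) (allFin n)
  ∑-allFin-suc b = cong ((if does (fzero ≟ᶠ b) then 1 else 0) +_)
    (trans (cong (ℕΣ.∑ F) (sym (List.map-tabulate (λ a → a) fsuc))) (ℕΣ.∑-map F fsuc (allFin n)))
    where F = λ (a : Fin (suc n)) → if does (a ≟ᶠ b) then 1 else 0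
  split : ∀ (b : Fin (suc n)) →
          (if does (fzero ≟ᶠ b) then 1 else 0) + ℕΣ.∑ (λ a → if does (fsuc a ≟ᶠ b) then 1 else 0) (allFin n) ≡ 1
  split fzero    = cong suc (ℕΣ.∑-0 (allFin n))
  split (fsuc b) = multiplicity-allFin b

module _ {γ : ℕ} where

  _≟ᵛ_ : DecidableEquality (VTree γ)
  _≟ᵇ_ : DecidableEquality (Branch γ)

  bin l r ≟ᵛ bin l′ r′ = map′ (λ { (refl , refl) → refl }) (λ { refl → refl , refl }) (l ≟ᵇ l′ ×-dec r ≟ᵇ r′)

  nil      ≟ᵇ nil      = yes refl
  nil      ≟ᵇ edge _ _ = no λ ()
  edge _ _ ≟ᵇ nil      = no λ ()
  edge a x ≟ᵇ edge b y = map′ (λ { (refl , refl) → refl }) (λ { refl → refl , refl }) (a ≟ᶠ b ×-dec x ≟ᵛ y)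

  size : VTree γ → ℕ
  bsize : Branch γ → ℕ
  size (bin l r) = suc (bsize l + bsize r)
  bsize nil        = 0
  bsize (edge _ x) = size x

  arity-emb : ∀ w → arity (emb w) ≡ size w
  arity-embᴿ : ∀ r → arity (embᴿ r) ≡ suc (bsize r)
  arity-emb (bin nil        r) = arity-embᴿ r
  arity-emb (bin (edge a x) r) = trans (cong₂ _+_ (arity-emb x) (arity-embᴿ r)) (ℕ.+-suc (size x) (bsize r))
  arity-embᴿ nil        = refl
  arity-embᴿ (edge b x) = cong suc (arity-emb x)

  pairs : List (Branch γ) → List (Branch γ) → List (VTree γ)
  pairs ls rs = concatMap (λ l → map (bin l) rs) ls

  multiplicity-pairs : ∀ l r ls rs →
    multiplicity _≟ᵛ_ (bin l r) (pairs ls rs) ≡ multiplicity _≟ᵇ_ l ls * multiplicity _≟ᵇ_ r rs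
  multiplicity-pairs l r ls rs = begin
    multiplicity _≟ᵛ_ (bin l r) (pairs ls rs)
      ≡⟨ ℕΣ.∑-concatMap _ _ ls ⟩
    ℕΣ.∑ (λ l′ → multiplicity _≟ᵛ_ (bin l r) (map (bin l′) rs)) ls
      ≡⟨ ℕΣ.∑-cong (λ l′ → trans (ℕΣ.∑-map _ (bin l′) rs) (ℕΣ.∑-cong (λ r′ → if-∧ (does (l′ ≟ᵇ l)) (does (r′ ≟ᵇ r))) rs)) ls ⟩
    ℕΣ.∑ (λ l′ → ℕΣ.∑ (λ r′ → 𝟙 l′ l * 𝟙 r′ r) rs) ls
      ≡⟨ ℕΣ.∑-cong (λ l′ → ℕΣ.∑-*ˡ (𝟙 l′ l) _ rs) ls ⟩
    ℕΣ.∑ (λ l′ → 𝟙 l′ l * multiplicity _≟ᵇ_ r rs) ls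
      ≡⟨ ℕΣ.∑-*ʳ _ _ ls ⟩
    multiplicity _≟ᵇ_ l ls * multiplicity _≟ᵇ_ r rs ∎
    where
    open ≡-Reasoning
    𝟙 : Branch γ → Branch γ → ℕ
    𝟙 u v = if does (u ≟ᵇ v) then 1 else 0

  edges : List (VTree γ) → List (Branch γ)
  edges ws = concatMap (λ a → map (edge a) ws) (allFin γ)

  multiplicity-edges : ∀ b w ws → multiplicity _≟ᵇ_ (edge b w) (edges ws) ≡ multiplicity _≟ᵛ_ w ws
  multiplicity-edges b w ws = begin
    multiplicity _≟ᵇ_ (edge b w) (edges ws)
      ≡⟨ ℕΣ.∑-concatMap _ _ (allFin γ) ⟩
    ℕΣ.∑ (λ a → multiplicity _≟ᵇ_ (edge b w) (map (edge a) ws)) (allFin γ)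
      ≡⟨ ℕΣ.∑-cong (λ a → trans (ℕΣ.∑-map _ (edge a) ws) (ℕΣ.∑-cong (λ w′ → if-∧ (does (a ≟ᶠ b)) (does (w′ ≟ᵛ w))) ws)) (allFin γ) ⟩
    ℕΣ.∑ (λ a → ℕΣ.∑ (λ w′ → 𝟙 a * (if does (w′ ≟ᵛ w) then 1 else 0)) ws) (allFin γ)
      ≡⟨ ℕΣ.∑-cong (λ a → ℕΣ.∑-*ˡ (𝟙 a) _ ws) (allFin γ) ⟩
    ℕΣ.∑ (λ a → 𝟙 a * multiplicity _≟ᵛ_ w ws) (allFin γ)
      ≡⟨ ℕΣ.∑-*ʳ _ _ (allFin γ) ⟩
    multiplicity _≟ᶠ_ b (allFin γ) * multiplicity _≟ᵛ_ w ws
      ≡⟨ cong (_* multiplicity _≟ᵛ_ w ws) (multiplicity-allFin b) ⟩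
    1 * multiplicity _≟ᵛ_ w ws
      ≡⟨ ℕ.*-identityˡ _ ⟩
    multiplicity _≟ᵛ_ w ws ∎
    where
    open ≡-Reasoning
    𝟙 : Fin γ → ℕ
    𝟙 a = if does (a ≟ᶠ b) then 1 else 0

  multiplicity-nil-edges : ∀ ws → multiplicity _≟ᵇ_ nil (edges ws) ≡ 0
  multiplicity-nil-edges ws = begin
    multiplicity _≟ᵇ_ nil (edges ws)                                ≡⟨ ℕΣ.∑-concatMap _ _ (allFin γ) ⟩
    ℕΣ.∑ (λ a → multiplicity _≟ᵇ_ nil (map (edge a) ws)) (allFin γ) ≡⟨ ℕΣ.∑-cong (λ a → trans (ℕΣ.∑-map _ (edge a) ws) (ℕΣ.∑-0 ws)) (allFin γ) ⟩
    ℕΣ.∑ (λ _ → 0) (allFin γ)                                       ≡⟨ ℕΣ.∑-0 (allFin γ) ⟩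
    0                                                               ∎
    where open ≡-Reasoning

  -- Any fuel f ≥ n gives the same list (trees-saturated); it only drives the recursion.
  trees : ℕ → ℕ → List (VTree γ)
  branches : ℕ → ℕ → List (Branch γ)
  trees f       zero    = []
  trees zero    (suc n) = []
  trees (suc f) (suc n) = concatMap (λ i → pairs (branches f i) (branches f (n ∸ i))) (upTo (suc n))
  branches f zero    = [ nil ]
  branches f (suc k) = edges (trees f (suc k))

  multiplicity-trees : ∀ f n w → n ≤ f → multiplicity _≟ᵛ_ w (trees f n) ≡ δ (size w) n
  multiplicity-branches : ∀ f k b → k ≤ f → multiplicity _≟ᵇ_ b (branches f k) ≡ δ (bsize b) k

  multiplicity-trees f       zero    (bin l r) _         = refl
  multiplicity-trees (suc f) (suc n) (bin l r) (s≤s n≤f) = begin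
    multiplicity _≟ᵛ_ (bin l r) (trees (suc f) (suc n))
      ≡⟨ ℕΣ.∑-concatMap _ (λ i → pairs (branches f i) (branches f (n ∸ i))) (upTo (suc n)) ⟩
    ℕΣ.∑ (λ i → multiplicity _≟ᵛ_ (bin l r) (pairs (branches f i) (branches f (n ∸ i)))) (upTo (suc n))
      ≡⟨ ℕΣ.∑-cong (λ i → multiplicity-pairs l r (branches f i) (branches f (n ∸ i))) (upTo (suc n)) ⟩
    ℕΣ.∑ (λ i → multiplicity _≟ᵇ_ l (branches f i) * multiplicity _≟ᵇ_ r (branches f (n ∸ i))) (upTo (suc n))
      ≡⟨ ℕΣ.∑-cong∈ (upTo (suc n)) (λ i i∈ → cong₂ _*_
           (multiplicity-branches f i l (ℕ.≤-trans (ℕ.≤-pred (∈-upTo⁻ i∈)) n≤f))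
           (multiplicity-branches f (n ∸ i) r (ℕ.≤-trans (ℕ.m∸n≤m n i) n≤f))) ⟩
    ℕΣ.∑ (λ i → δ (bsize l) i * δ (bsize r) (n ∸ i)) (upTo (suc n))
      ≡⟨ ∑-δδ (bsize l) (bsize r) n ⟩
    δ (bsize l + bsize r) n ∎
    where open ≡-Reasoning

  multiplicity-branches f zero    nil                 _  = refl
  multiplicity-branches f zero    (edge a (bin l r))  _  = refl
  multiplicity-branches f (suc k) nil                 _  = multiplicity-nil-edges (trees f (suc k))
  multiplicity-branches f (suc k) (edge b w)          le =
    trans (multiplicity-edges b w (trees f (suc k))) (multiplicity-trees f (suc k) w le)

  trees-fuel : ∀ f n → n ≤ f → trees (suc f) n ≡ trees f n
  branches-fuel : ∀ f k → k ≤ f → branches (suc f) k ≡ branches f k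
  trees-fuel f       zero    _         = refl
  trees-fuel (suc f) (suc n) (s≤s n≤f) = cong concat (List.map-cong-local (applyUpTo⁺₁ (λ i → i) (suc n) λ {i} i<1+n →
    cong₂ pairs (branches-fuel f i (ℕ.≤-trans (ℕ.≤-pred i<1+n) n≤f)) (branches-fuel f (n ∸ i) (ℕ.≤-trans (ℕ.m∸n≤m n i) n≤f))))
  branches-fuel f zero    _  = refl
  branches-fuel f (suc k) le = cong edges (trees-fuel f (suc k) le)

  trees-saturated : ∀ {f n} → n ≤ f → trees f n ≡ trees n n
  trees-saturated {f} {n} n≤f = trans (cong (λ g → trees g n) (sym (ℕ.m∸n+n≡m n≤f))) (go (f ∸ n))
    where
    go : ∀ d → trees (d + n) n ≡ trees n n
    go zero    = refl
    go (suc d) = trans (trees-fuel (d + n) n (ℕ.m≤n+m n d)) (go d)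

length-concatMap : ∀ {A B : Set} (g : A → List B) xs → length (concatMap g xs) ≡ ℕΣ.∑ (length ∘ g) xs
length-concatMap g []       = refl
length-concatMap g (x ∷ xs) = trans (List.length-++ (g x)) (cong (length (g x) +_) (length-concatMap g xs))

∑-const : ∀ {A : Set} c (xs : List A) → ℕΣ.∑ (λ _ → c) xs ≡ length xs * c
∑-const c []       = refl
∑-const c (x ∷ xs) = cong (c +_) (∑-const c xs)

length-map-concatMap : ∀ {A B C : Set} (f : A → B → C) xs ys →
                       length (concatMap (λ x → map (f x) ys) xs) ≡ length xs * length ys
length-map-concatMap f xs ys = begin
  length (concatMap (λ x → map (f x) ys) xs)    ≡⟨ length-concatMap (λ x → map (f x) ys) xs ⟩
  ℕΣ.∑ (λ x → length (map (f x) ys)) xs         ≡⟨ ℕΣ.∑-cong (λ x → List.length-map (f x) ys) xs ⟩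
  ℕΣ.∑ (λ _ → length ys) xs                     ≡⟨ ∑-const (length ys) xs ⟩
  length xs * length ys                         ∎
  where open ≡-Reasoning

module _ (γ : ℕ) where

  dim : ℕ → ℕ
  dim n = length (trees {γ} n n)

  length-branches : ∀ f i → i ≤ f → length (branches {γ} f i) ≡ δ i 0 + γ * dim i
  length-branches f zero    _  = cong suc (sym (ℕ.*-zeroʳ γ))
  length-branches f (suc k) le = begin
    length (edges (trees {γ} f (suc k)))             ≡⟨ length-map-concatMap edge (allFin γ) (trees f (suc k)) ⟩
    length (allFin γ) * length (trees {γ} f (suc k)) ≡⟨ cong₂ _*_ (List.length-tabulate {n = γ} (λ a → a)) (cong length (trees-saturated le)) ⟩
    γ * dim (suc k)                                ∎
    where open ≡-Reasoning

  dim-suc : ∀ n → dim (suc n) ≡ δ₀ n + 2 * γ * dim n + γ * γ * conv dim n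
  dim-suc n = begin
    length (concatMap {B = VTree γ} (λ i → pairs (branches n i) (branches n (n ∸ i))) (upTo (suc n)))
      ≡⟨ length-concatMap (λ i → pairs (branches n i) (branches n (n ∸ i))) (upTo (suc n)) ⟩
    ℕΣ.∑ (λ i → length (pairs (branches n i) (branches n (n ∸ i)))) (upTo (suc n))
      ≡⟨ ℕΣ.∑-cong∈ (upTo (suc n)) (λ i i∈ → trans (length-map-concatMap bin (branches n i) (branches n (n ∸ i)))
           (cong₂ _*_ (length-branches n i (ℕ.≤-pred (∈-upTo⁻ i∈))) (length-branches n (n ∸ i) (ℕ.m∸n≤m n i)))) ⟩
    ℕΣ.∑ (λ i → (δ i 0 + γ * dim i) * (δ (n ∸ i) 0 + γ * dim (n ∸ i))) (upTo (suc n))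
      ≡⟨ ∑-convolution γ dim n ⟩
    δ₀ n + 2 * γ * dim n + γ * γ * conv dim n ∎
    where open ≡-Reasoning

-- The dimension of Dendr_γ(n)

module _ {γ : ℕ} where

  normalize-emb : ∀ (w : VTree γ) → normalize (emb w) ≡ [ w ]
  normalize-embᴿ : ∀ (r : Branch γ) → normalize (embᴿ r) ≡ [ bin nil r ]
  normalize-emb (bin nil        r) = normalize-embᴿ r
  normalize-emb (bin (edge a x) r) rewrite normalize-emb x | normalize-embᴿ r = refl
  normalize-embᴿ nil        = refl
  normalize-embᴿ (edge b x) rewrite normalize-emb x = refl

  unemb : Tree γ → Maybe (VTree γ)
  unembᴿ : Tree γ → Maybe (Branch γ)
  unemb (node (succ a) s t) = Maybe.zipWith (λ x r → bin (edge a x) r) (unemb s) (unembᴿ t)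
  unemb s                   = Maybe.map (bin nil) (unembᴿ s)
  unembᴿ leaf                   = just nil
  unembᴿ (node (prec b) leaf t) = Maybe.map (edge b) (unemb t)
  unembᴿ _                      = nothing

  unemb-emb : ∀ w → unemb (emb w) ≡ just w
  unembᴿ-embᴿ : ∀ r → unembᴿ (embᴿ r) ≡ just r
  unemb-emb (bin nil        nil)        = refl
  unemb-emb (bin nil        (edge b x)) rewrite unemb-emb x = refl
  unemb-emb (bin (edge a x) r)          rewrite unemb-emb x | unembᴿ-embᴿ r = refl
  unembᴿ-embᴿ nil        = refl
  unembᴿ-embᴿ (edge b x) rewrite unemb-emb x = refl

  emb-unemb : ∀ s {w} → unemb s ≡ just w → emb w ≡ s
  embᴿ-unembᴿ : ∀ s {r} → unembᴿ s ≡ just r → embᴿ r ≡ s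
  emb-unemb (node (succ a) s t) eq with unemb s in eq₁ | unembᴿ t in eq₂
  ... | just x | just r with refl ← eq = cong₂ (node (succ a)) (emb-unemb s eq₁) (embᴿ-unembᴿ t eq₂)
  emb-unemb leaf                refl = refl
  emb-unemb (node (prec b) s t) eq with unembᴿ (node (prec b) s t) in eq₁
  ... | just r with refl ← eq = embᴿ-unembᴿ (node (prec b) s t) eq₁
  embᴿ-unembᴿ leaf                   refl = refl
  embᴿ-unembᴿ (node (prec b) leaf t) eq with unemb t in eq₁
  ... | just x with refl ← eq = cong (node (prec b) leaf) (emb-unemb t eq₁)

  emb-injective : ∀ {u w : VTree γ} → emb u ≡ emb w → u ≡ w
  emb-injective {u} {w} eq = Maybe.just-injective (trans (sym (unemb-emb u)) (trans (cong unemb eq) (unemb-emb w)))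

  eval-toComb : ∀ G (ws : List (VTree γ)) → eval G (toComb ws) ≡ ∑ (G ∘ emb) ws
  eval-toComb G ws = trans (∑-map _ _ ws) (∑-cong (λ w → ℚ.*-identityˡ (G (emb w))) ws)

  eval-normalForm : ∀ G (X : Comb γ) → eval G (normalForm X) ≡ eval (normalized (G ∘ emb)) X
  eval-normalForm G X = begin
    eval G (normalForm X)                                                  ≡⟨ ∑-concatMap _ _ X ⟩
    ∑ (λ p → eval G (scale (proj₁ p) (toComb (normalize (proj₂ p))))) X    ≡⟨ ∑-cong (λ p → eval-scale G (proj₁ p) (toComb (normalize (proj₂ p)))) X ⟩
    ∑ (λ p → proj₁ p *q eval G (toComb (normalize (proj₂ p)))) X           ≡⟨ eval-cong (λ t → eval-toComb G (normalize t)) X ⟩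
    eval (normalized (G ∘ emb)) X                                          ∎
    where open ≡-Reasoning

  coordinate : VTree γ → Tree γ → ℚ
  coordinate w = normalized (λ u → if does (u ≟ᵛ w) then 1ℚ else 0ℚ)

  coordinate-emb : ∀ w u → coordinate w (emb u) ≡ (if does (u ≟ᵛ w) then 1ℚ else 0ℚ)
  coordinate-emb w u = trans (cong (∑ _) (normalize-emb u)) (ℚ.+-identityʳ _)

  𝟙-emb : ∀ (w u : VTree γ) → 𝟙[ emb w ] (emb u) ≡ (if does (u ≟ᵛ w) then 1ℚ else 0ℚ)
  𝟙-emb w u with u ≟ᵛ w
  ... | yes refl = cong (λ b → if b then 1ℚ else 0ℚ) (dec-true (emb u ≟ᵗ emb u) refl)
  ... | no u≢w   = cong (λ b → if b then 1ℚ else 0ℚ) (dec-false (emb u ≟ᵗ emb w) (u≢w ∘ emb-injective))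

  combOf : (ws : List (VTree γ)) → (Fin (length ws) → ℚ) → Comb γ
  combOf []       v = []
  combOf (w ∷ ws) v = (v fzero , emb w) ∷ combOf ws (v ∘ fsuc)

  combOf-homogeneous : ∀ n ws v → (∀ i → size (lookup ws i) ≡ n) → HomogeneousOf n (combOf ws v)
  combOf-homogeneous n []       v sizes = []
  combOf-homogeneous n (w ∷ ws) v sizes =
    trans (arity-emb w) (sizes fzero) ∷ combOf-homogeneous n ws (v ∘ fsuc) (sizes ∘ fsuc)

  multiplicity-lookup : ∀ (ws : List (VTree γ)) i → 1 ≤ multiplicity _≟ᵛ_ (lookup ws i) ws
  multiplicity-lookup (w ∷ ws) fzero    rewrite dec-true (w ≟ᵛ w) refl = s≤s z≤n
  multiplicity-lookup (w ∷ ws) (fsuc i) = ℕ.≤-trans (multiplicity-lookup ws i) (ℕ.m≤n+m _ _)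

  lookup-multiplicity : ∀ (ws : List (VTree γ)) w → 1 ≤ multiplicity _≟ᵛ_ w ws → Σ (Fin (length ws)) λ i → lookup ws i ≡ w
  lookup-multiplicity (u ∷ ws) w 1≤m with u ≟ᵛ w
  ... | yes u≡w = fzero , u≡w
  ... | no _    = let (i , wᵢ≡w) = lookup-multiplicity ws w 1≤m in fsuc i , wᵢ≡w

  eval-combOf-absent : ∀ w ws v → multiplicity _≟ᵛ_ w ws ≡ 0 → eval (coordinate w) (combOf ws v) ≡ 0ℚ
  eval-combOf-absent w []       v _   = refl
  eval-combOf-absent w (u ∷ ws) v m≡0 with u ≟ᵛ w | coordinate-emb w u
  ... | no _ | uᵢ≡0 = begin
    v fzero *q coordinate w (emb u) +q eval (coordinate w) (combOf ws (v ∘ fsuc))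
      ≡⟨ cong₂ _+q_ (trans (cong (v fzero *q_) uᵢ≡0) (ℚ.*-zeroʳ (v fzero))) (eval-combOf-absent w ws (v ∘ fsuc) m≡0) ⟩
    0ℚ +q 0ℚ ≡⟨ ℚ.+-identityʳ 0ℚ ⟩
    0ℚ ∎
    where open ≡-Reasoning

  eval-combOf-unique : ∀ ws v i → multiplicity _≟ᵛ_ (lookup ws i) ws ≡ 1 → eval (coordinate (lookup ws i)) (combOf ws v) ≡ v i
  eval-combOf-unique (w ∷ ws) v fzero m≡1 with w ≟ᵛ w | coordinate-emb w w
  ... | no w≢w   | _    = ⊥-elim (w≢w refl)
  ... | yes refl | wᵢ≡1 = begin
    v fzero *q coordinate w (emb w) +q eval (coordinate w) (combOf ws (v ∘ fsuc))
      ≡⟨ cong₂ _+q_ (trans (cong (v fzero *q_) wᵢ≡1) (ℚ.*-identityʳ (v fzero))) (eval-combOf-absent w ws (v ∘ fsuc) (ℕ.suc-injective m≡1)) ⟩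
    v fzero +q 0ℚ ≡⟨ ℚ.+-identityʳ (v fzero) ⟩
    v fzero ∎
    where open ≡-Reasoning
  eval-combOf-unique (u ∷ ws) v (fsuc i) m≡1 with u ≟ᵛ lookup ws i | coordinate-emb (lookup ws i) u
  ... | yes refl | _    = ⊥-elim (ℕ.<-irrefl refl (ℕ.≤-trans (s≤s (multiplicity-lookup ws i)) (ℕ.≤-reflexive m≡1)))
  ... | no _     | uᵢ≡0 = begin
    v fzero *q coordinate (lookup ws i) (emb u) +q eval (coordinate (lookup ws i)) (combOf ws (v ∘ fsuc))
      ≡⟨ cong₂ _+q_ (trans (cong (v fzero *q_) uᵢ≡0) (ℚ.*-zeroʳ (v fzero))) (eval-combOf-unique ws (v ∘ fsuc) i m≡1) ⟩
    0ℚ +q v (fsuc i) ≡⟨ ℚ.+-identityˡ (v (fsuc i)) ⟩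
    v (fsuc i) ∎
    where open ≡-Reasoning

  expand-arity : ∀ (ρ : RTree γ) → HomogeneousOf (rarity ρ) (expand ρ)
  expand-arity (here (r₁ _ _) x y z) = refl ∷ sym (ℕ.+-assoc (arity x) _ _) ∷ []
  expand-arity (here (r₂ _ _) x y z) = refl ∷ sym (ℕ.+-assoc (arity x) _ _) ∷ sym (ℕ.+-assoc (arity x) _ _) ∷ []
  expand-arity (here (r₃ _ _) x y z) = refl ∷ refl ∷ sym (ℕ.+-assoc (arity x) _ _) ∷ []
  expand-arity (left g ρ t)          = All.map⁺ (All.map (cong (_+ arity t)) (expand-arity ρ))
  expand-arity (right g t ρ)         = All.map⁺ (All.map (cong (arity t +_)) (expand-arity ρ))

  spanned-homogeneous : ∀ {m} (ys : List (ℚ × RTree γ)) → All (λ p → rarity (proj₂ p) ≡ m) ys → HomogeneousOf m (spanned ys)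
  spanned-homogeneous []             []             = []
  spanned-homogeneous ((c , ρ) ∷ ys) (refl ∷ same) =
    All.++⁺ (All.map⁺ (expand-arity ρ)) (spanned-homogeneous ys same)

  coeff-other-arity : ∀ {m} (X : Comb γ) t → HomogeneousOf m X → arity t ≢ m → coeff X t ≡ 0ℚ
  coeff-other-arity []            t []             _    = refl
  coeff-other-arity ((c , s) ∷ X) t (refl ∷ hom) t≢m =
    trans (coeff-∷-≢ c {s} X λ { refl → t≢m refl }) (coeff-other-arity X t hom t≢m)

  spanned-annihilated : ∀ F (ys : List (ℚ × RTree γ)) → eval (normalized F) (spanned ys) ≡ 0ℚ
  spanned-annihilated F ys = begin
    eval (normalized F) (spanned ys)                                ≡⟨ eval-spanned (normalized F) ys ⟩
    ∑ (λ p → proj₁ p *q eval (normalized F) (expand (proj₂ p))) ys  ≡⟨ ∑-cong (λ p → trans (cong (proj₁ p *q_) (expand-annihilated (proj₂ p) F)) (ℚ.*-zeroʳ (proj₁ p))) ys ⟩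
    ∑ (λ _ → 0ℚ) ys                                                 ≡⟨ ∑-0 ys ⟩
    0ℚ                                                              ∎
    where open ≡-Reasoning

  coeff-spanned-filter : ∀ m (ys : List (ℚ × RTree γ)) t → arity t ≡ m →
                         coeff (spanned ys) t ≡ coeff (spanned (filter (λ p → rarity (proj₂ p) ℕ.≟ m) ys)) t
  coeff-spanned-filter m ys t refl = begin
    coeff (spanned ys) t                                   ≡⟨ trans (coeff-eval (spanned ys) t) (eval-spanned 𝟙[ t ] ys) ⟩
    ∑ F ys                                                 ≡⟨ ∑-filter (λ p → rarity (proj₂ p) ℕ.≟ m) F other ys ⟨
    ∑ F (filter (λ p → rarity (proj₂ p) ℕ.≟ m) ys)         ≡⟨ trans (coeff-eval (spanned ys′) t) (eval-spanned 𝟙[ t ] ys′) ⟨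
    coeff (spanned (filter (λ p → rarity (proj₂ p) ℕ.≟ m) ys)) t ∎
    where
    open ≡-Reasoning
    ys′ = filter (λ p → rarity (proj₂ p) ℕ.≟ m) ys
    F : ℚ × RTree γ → ℚ
    F p = proj₁ p *q eval 𝟙[ t ] (expand (proj₂ p))
    other : ∀ p → rarity (proj₂ p) ≢ m → F p ≡ 0ℚ
    other (c , ρ) ρ≢m = trans (cong (c *q_) (trans (sym (coeff-eval (expand ρ) t))
                                (coeff-other-arity (expand ρ) t (expand-arity ρ) (λ eq → ρ≢m (sym eq)))))
                              (ℚ.*-zeroʳ c)

module _ (γ n : ℕ) where

  basis : List (VTree γ)
  basis = trees n n

  size-basis : ∀ i → size (lookup basis i) ≡ n
  size-basis i = δ-sound _ n (subst (1 ≤_) (multiplicity-trees n n (lookup basis i) ℕ.≤-refl) (multiplicity-lookup basis i))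

  basis-unique : ∀ i → multiplicity _≟ᵛ_ (lookup basis i) basis ≡ 1
  basis-unique i = trans (multiplicity-trees n n _ ℕ.≤-refl) (trans (cong (λ k → δ k n) (size-basis i)) (δ-refl n))

  basis-complete : ∀ w → size w ≡ n → Σ (Fin (dim γ n)) λ i → lookup basis i ≡ w
  basis-complete w refl =
    lookup-multiplicity basis w (ℕ.≤-reflexive (sym (trans (multiplicity-trees n n w ℕ.≤-refl) (δ-refl n))))

  φ : Tree γ → Fin (dim γ n) → ℚ
  φ t i = coordinate (lookup basis i) t

  φ-surjective : ∀ v → Σ (Comb γ) λ x → HomogeneousOf n x × (∀ i → applyLin φ x i ≡ v i)
  φ-surjective v = combOf basis v , combOf-homogeneous n basis v size-basis ,
    λ i → trans (applyLin-eval φ (combOf basis v) i) (eval-combOf-unique basis v i (basis-unique i))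

  ideal⇒kernel : ∀ x → InIdeal n x → ∀ i → applyLin φ x i ≡ 0ℚ
  ideal⇒kernel x (ys , _ , same) i = begin
    applyLin φ x i                                 ≡⟨ applyLin-eval φ x i ⟩
    eval (coordinate (lookup basis i)) x           ≡⟨ eval-coeff-cong _ x (spanned ys) same ⟩
    eval (coordinate (lookup basis i)) (spanned ys) ≡⟨ spanned-annihilated _ ys ⟩
    0ℚ                                             ∎
    where open ≡-Reasoning

  normalForm-null : ∀ x → (∀ i → applyLin φ x i ≡ 0ℚ) → ∀ s → arity s ≡ n → eval 𝟙[ s ] (normalForm x) ≡ 0ℚ
  normalForm-null x null s arity≡n with unemb s in eq
  ... | just w with refl ← emb-unemb s eq = begin
    eval 𝟙[ emb w ] (normalForm x)                   ≡⟨ eval-normalForm 𝟙[ emb w ] x ⟩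
    eval (normalized (𝟙[ emb w ] ∘ emb)) x           ≡⟨ eval-cong (λ t → ∑-cong (𝟙-emb w) (normalize t)) x ⟩
    eval (coordinate w) x                            ≡⟨ cong (λ u → eval (coordinate u) x) wᵢ≡w ⟨
    eval (coordinate (lookup basis i)) x             ≡⟨ applyLin-eval φ x i ⟨
    applyLin φ x i                                   ≡⟨ null i ⟩
    0ℚ                                               ∎
    where
    open ≡-Reasoning
    i = proj₁ (basis-complete w (trans (sym (arity-emb w)) arity≡n))
    wᵢ≡w = proj₂ (basis-complete w (trans (sym (arity-emb w)) arity≡n))
  ... | nothing = begin
    eval 𝟙[ s ] (normalForm x)                       ≡⟨ eval-normalForm 𝟙[ s ] x ⟩
    eval (normalized (𝟙[ s ] ∘ emb)) x               ≡⟨ eval-cong (λ t → trans (∑-cong not-normal (normalize t)) (∑-0 (normalize t))) x ⟩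
    eval (λ _ → 0ℚ) x                                ≡⟨ eval-0 x ⟩
    0ℚ                                               ∎
    where
    open ≡-Reasoning
    not-normal : ∀ u → 𝟙[ s ] (emb u) ≡ 0ℚ
    not-normal u = cong (λ b → if b then 1ℚ else 0ℚ) (dec-false (emb u ≟ᵗ s)
      λ { refl → case (trans (sym eq) (unemb-emb u)) })
      where
      case : nothing ≡ just u → _
      case ()

  kernel⇒ideal : ∀ x → HomogeneousOf n x → (∀ i → applyLin φ x i ≡ 0ℚ) → InIdeal n x
  kernel⇒ideal x hom null with ≈ᴵ-normalForm x
  ... | ys by x≈ = ys′ , All.all-filter P? ys , same
    where
    P? = λ (p : ℚ × RTree γ) → rarity (proj₂ p) ℕ.≟ n
    ys′ = filter P? ys
    same : ∀ t → coeff x t ≡ coeff (spanned ys′) t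
    same t with arity t ℕ.≟ n
    ... | yes arity≡n = begin
      coeff x t                                              ≡⟨ coeff-eval x t ⟩
      eval 𝟙[ t ] x                                          ≡⟨ x≈ 𝟙[ t ] ⟩
      eval 𝟙[ t ] (normalForm x) +q eval 𝟙[ t ] (spanned ys) ≡⟨ cong₂ _+q_ (normalForm-null x null t arity≡n) (sym (coeff-eval (spanned ys) t)) ⟩
      0ℚ +q coeff (spanned ys) t                             ≡⟨ ℚ.+-identityˡ _ ⟩
      coeff (spanned ys) t                                   ≡⟨ coeff-spanned-filter n ys t arity≡n ⟩
      coeff (spanned ys′) t                                  ∎
      where open ≡-Reasoning
    ... | no arity≢n = trans (coeff-other-arity x t hom arity≢n)
      (sym (coeff-other-arity (spanned ys′) t (spanned-homogeneous ys′ (All.all-filter P? ys)) arity≢n))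

  dimDendr : DimDendr γ n (dim γ n)
  dimDendr = φ , φ-surjective , λ x hom → mk⇔ (kernel⇒ideal x hom) (ideal⇒kernel x)

proposition2p1p2 : (γ : ℕ) →
    Σ (ℕ → ℕ) λ h →
      (h 0 ≡ 0) ×
      (∀ n → 1 ≤ n → DimDendr γ n (h n)) ×
      (∀ n → h (suc n) ≡ δ₀ n + 2 * γ * h n + γ * γ * conv h n)
proposition2p1p2 γ = dim γ , refl , (λ n _ → dimDendr γ n) , dim-suc γ
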